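{- Let $P=(I,J,\emptyset)$ be a reduced presentation and let $\mathbf B_\Delta$ be the algebra associated with $P$ as defined below. Then for every $j\in J$, $\mathbf{Ł}_{j,1}$ is embeddable in $\mathbf B_\Delta$.
   Context: A Wajsberg hoop is a commutative integral residuated lattice $\langle A,\vee,\wedge,\cdot,\rightarrow,1\rangle$ satisfying $(x\rightarrow y)\vee(y\rightarrow x)\approx1$, $x(x\rightarrow y)\approx y(y\rightarrow x)$ and $(x\rightarrow y)\rightarrow y\approx(y\rightarrow x)\rightarrow x$. For a totally ordered abelian group $\mathbf G$ with strong unit $u>0$, $\Gamma(\mathbf G,u)$ is the Wajsberg hoop on $\{a\in G:0\le a\le u\}$ with $a\cdot b=\max\{a+b-u,0\}$, $a\rightarrow b=\min\{u-a+b,u\}$, top $u$; in it $\neg a:=a\rightarrow0$. $\mathbb Z\times_l\mathbb Z$ is the lexicographic product of two copies of $\mathbb Z$ (first coordinate dominant). $\mathbf{Ł}_n=\Gamma(\mathbb Z,n)$ (universe $\{0,\dots,n\}$), $\mathbf{Ł}_{n,k}=\Gamma(\mathbb Z\times_l\mathbb Z,(n,k))$. A reduced presentation with $K=\emptyset$ is $P=(I,J,\emptyset)$ with $I,J$ finite sets of positive integers, $I\cup J\ne\emptyset$, no $m\in I$ dividing any element of $(I\setminus\{m\})\cup J$, and no $n\in J$ dividing any element of $J\setminus\{n\}$. $X{\downarrow}$ is the set of divisors of elements of $X$. For $k\ge2$, $0<h<k$ relatively prime, $g_{k,h}$ is the unique generator $g$ of $\mathbf{Ł}_{k,h}$ with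 $g\le\neg g$; $g_{1,0}=(0,1)\in\mathbf{Ł}_{1,0}$. Let $\Delta=\{(k,h,2):0\le h<k\in I{\downarrow},\ \gcd(k,h)=1\}\cup\{(k,h,i):i\in\{0,1\},\ 0\le h<k\in J{\downarrow},\ \gcd(k,h)=1\}$, $\mathbf A_\Delta=\prod_{(k,h,i)\in\Delta}\mathbf A^i_{k,h}$ with $\mathbf A^0_{k,h}=\mathbf A^1_{k,h}=\mathbf{Ł}_{k,h}$ and $\mathbf A^2_{k,h}=\mathbf{Ł}_k$, and $\bar g\in A_\Delta$ given by $\bar g(k,h,2)=h$, $\bar g(k,h,0)=g_{k,h}$, $\bar g(k,h,1)=\neg g_{k,h}$; $\mathbf B_\Delta$ is the subalgebra of $\mathbf A_\Delta$ generated by $\bar g$. -}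

module Defs where

open import Data.Bool using (Bool; true; false; T; if_then_else_; _∧_; _∨_; not)
open import Data.Nat as ℕ using (ℕ; zero; suc; _<_; _≤_)
open import Data.Nat.Divisibility using (_∣_)
open import Data.Nat.Coprimality using (Coprime)
open import Data.Integer as ℤ using (ℤ; +_)
open import Data.Fin using (Fin) renaming (zero to f0; suc to fs)
open import Data.Product using (Σ; ∃; _×_; _,_)
open import Data.List using (List; [])
import Data.Sum
open import Data.List.Membership.Propositional using (_∈_)
open import Relation.Binary.PropositionalEquality using (_≡_; _≢_)
open import Relation.Nullary using (¬_)

record OAG : Set₁ where
  field
    G    : Set
    _⊕_  : G → G → G
    ⊖_   : G → G
    o    : G
    _≤ᵇ_ : G → G → Bool

ℤ-OAG : OAG
ℤ-OAG = record { G = ℤ ; _⊕_ = ℤ._+_ ; ⊖_ = ℤ.-_ ; o = + 0 ; _≤ᵇ_ = ℤ._≤ᵇ_ }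

-- ℤ ×_l ℤ : lexicographic product, first coordinate dominant
lexLeq : ℤ × ℤ → ℤ × ℤ → Bool
lexLeq (a , b) (c , d) =
  not (c ℤ.≤ᵇ a) ∨ (((a ℤ.≤ᵇ c) ∧ (c ℤ.≤ᵇ a)) ∧ (b ℤ.≤ᵇ d))

ℤ×ℤ-OAG : OAG
ℤ×ℤ-OAG = record
  { G = ℤ × ℤ
  ; _⊕_ = λ { (a , b) (c , d) → (a ℤ.+ c , b ℤ.+ d) }
  ; ⊖_ = λ { (a , b) → (ℤ.- a , ℤ.- b) }
  ; o = (+ 0 , + 0)
  ; _≤ᵇ_ = lexLeq }

-- Algebras in the signature ⟨∨, ∧, ·, →, 1⟩, given by a carrier of raw
-- values, a universe predicate and an equality on the universe.

record RawHoop : Set₁ where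
  field
    Carrier : Set
    U       : Carrier → Set
    _≈_     : Carrier → Carrier → Set
    _∨'_ _∧'_ _·_ _⇒_ : Carrier → Carrier → Carrier
    one     : Carrier

module _ (A : OAG) where
  open OAG A
  maxG minG : G → G → G
  maxG x y = if x ≤ᵇ y then y else x
  minG x y = if x ≤ᵇ y then x else y

Γ : (A : OAG) → OAG.G A → RawHoop
Γ A u = record
  { Carrier = G
  ; U = λ a → T (o ≤ᵇ a) × T (a ≤ᵇ u)
  ; _≈_ = _≡_
  ; _∨'_ = maxG A
  ; _∧'_ = minG A
  ; _·_ = λ a b → maxG A ((a ⊕ b) ⊕ (⊖ u)) o
  ; _⇒_ = λ a b → minG A ((u ⊕ (⊖ a)) ⊕ b) u
  ; one = u }
  where open OAG A

negΓ : (A : OAG) → OAG.G A → OAG.G A → OAG.G A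
negΓ A u a = RawHoop._⇒_ (Γ A u) a (OAG.o A)

Ł : ℕ → RawHoop
Ł n = Γ ℤ-OAG (+ n)

Ł₂ : ℕ → ℕ → RawHoop
Ł₂ n k = Γ ℤ×ℤ-OAG (+ n , + k)

data Term : Set where
  varₜ oneₜ : Term
  _∨ₜ_ _∧ₜ_ _·ₜ_ _⇒ₜ_ : Term → Term → Term

eval : (A : RawHoop) → Term → RawHoop.Carrier A → RawHoop.Carrier A
eval A varₜ x = x
eval A oneₜ x = RawHoop.one A
eval A (s ∨ₜ t) x = RawHoop._∨'_ A (eval A s x) (eval A t x)
eval A (s ∧ₜ t) x = RawHoop._∧'_ A (eval A s x) (eval A t x)
eval A (s ·ₜ t) x = RawHoop._·_ A (eval A s x) (eval A t x)
eval A (s ⇒ₜ t) x = RawHoop._⇒_ A (eval A s x) (eval A t x)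

InGenerated : (A : RawHoop) → RawHoop.Carrier A → RawHoop.Carrier A → Set
InGenerated A g x = ∃ λ (t : Term) → RawHoop._≈_ A x (eval A t g)

IsGenerator : (A : RawHoop) → RawHoop.Carrier A → Set
IsGenerator A g = RawHoop.U A g × (∀ y → RawHoop.U A y → InGenerated A g y)

IsEmbedding : (A B : RawHoop) → (RawHoop.Carrier A → RawHoop.Carrier B) → (RawHoop.Carrier B → Set) → Set
IsEmbedding A B f V =
    (∀ x → U x → V (f x))
  × (∀ x y → U x → U y → f (x ∨' y) ≈B RawHoop._∨'_ B (f x) (f y))
  × (∀ x y → U x → U y → f (x ∧' y) ≈B RawHoop._∧'_ B (f x) (f y))
  × (∀ x y → U x → U y → f (x · y) ≈B RawHoop._·_ B (f x) (f y))
  × (∀ x y → U x → U y → f (x ⇒ y) ≈B RawHoop._⇒_ B (f x) (f y))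
  × (f one ≈B RawHoop.one B)
  × (∀ x y → U x → U y → f x ≈B f y → x ≈ y)
  where
    open RawHoop A
    _≈B_ = RawHoop._≈_ B

EmbeddableInGenerated : (A C : RawHoop) → RawHoop.Carrier C → Set
EmbeddableInGenerated A C g =
  Σ (RawHoop.Carrier A → RawHoop.Carrier C) λ f → IsEmbedding A C f (InGenerated C g)

-- Reduced presentations P = (I, J, ∅); finite sets given as lists

record ReducedPresentation (I J : List ℕ) : Set where
  field
    I-pos : ∀ {m} → m ∈ I → 0 < m
    J-pos : ∀ {n} → n ∈ J → 0 < n
    nonempty : Σ ℕ λ x → (x ∈ I) Data.Sum.⊎ (x ∈ J)
    I-I : ∀ {m m'} → m ∈ I → m' ∈ I → m' ≢ m → ¬ (m ∣ m')
    I-J : ∀ {m n} → m ∈ I → n ∈ J → ¬ (m ∣ n)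
    J-J : ∀ {n n'} → n ∈ J → n' ∈ J → n' ≢ n → ¬ (n ∣ n')

_∈↓_ : ℕ → List ℕ → Set
k ∈↓ X = Σ ℕ λ m → (m ∈ X) × (k ∣ m)

-- Choice of the generators g_{k,h}
-- A function gsel with gsel k h = g_{k,h}: for k ≥ 2, 0 < h < k coprime,
-- g_{k,h} is a generator of Ł_{k,h} with g ≤ ¬g (unique by the paper),
-- and g_{1,0} = (0,1).

IsGenSelection : (ℕ → ℕ → ℤ × ℤ) → Set
IsGenSelection gsel =
    (∀ k h → 2 ≤ k → 0 < h → h < k → Coprime k h →
       IsGenerator (Ł₂ k h) (gsel k h)
       × T (lexLeq (gsel k h) (negΓ ℤ×ℤ-OAG (+ k , + h) (gsel k h))))
  × (gsel 1 0 ≡ (+ 0 , + 1))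

Comp : Fin 3 → Set
Comp f0 = ℤ × ℤ
Comp (fs f0) = ℤ × ℤ
Comp (fs (fs f0)) = ℤ

Aᵢ : ℕ → ℕ → (i : Fin 3) → RawHoop
Aᵢ k h f0 = Ł₂ k h
Aᵢ k h (fs f0) = Ł₂ k h
Aᵢ k h (fs (fs f0)) = Ł k

compOK : ∀ k h i → RawHoop.Carrier (Aᵢ k h i) ≡ Comp i
compOK k h f0 = Relation.Binary.PropositionalEquality.refl
compOK k h (fs f0) = Relation.Binary.PropositionalEquality.refl
compOK k h (fs (fs f0)) = Relation.Binary.PropositionalEquality.refl

InΔ : List ℕ → List ℕ → ℕ → ℕ → Fin 3 → Set
InΔ I J k h f0 = (k ∈↓ J) × h < k × Coprime k h
InΔ I J k h (fs f0) = (k ∈↓ J) × h < k × Coprime k h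
InΔ I J k h (fs (fs f0)) = (k ∈↓ I) × h < k × Coprime k h

-- A_Δ = ∏_{(k,h,i) ∈ Δ} A^i_{k,h}; elements are families indexed by
-- (k,h,i), only their values on Δ matter.
A-Δ : List ℕ → List ℕ → RawHoop
A-Δ I J = record
  { Carrier = (k h : ℕ) (i : Fin 3) → RawHoop.Carrier (Aᵢ k h i)
  ; U = λ a → ∀ k h i → InΔ I J k h i → RawHoop.U (Aᵢ k h i) (a k h i)
  ; _≈_ = λ a b → ∀ k h i → InΔ I J k h i → RawHoop._≈_ (Aᵢ k h i) (a k h i) (b k h i)
  ; _∨'_ = λ a b k h i → RawHoop._∨'_ (Aᵢ k h i) (a k h i) (b k h i)
  ; _∧'_ = λ a b k h i → RawHoop._∧'_ (Aᵢ k h i) (a k h i) (b k h i)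
  ; _·_ = λ a b k h i → RawHoop._·_ (Aᵢ k h i) (a k h i) (b k h i)
  ; _⇒_ = λ a b k h i → RawHoop._⇒_ (Aᵢ k h i) (a k h i) (b k h i)
  ; one = λ k h i → RawHoop.one (Aᵢ k h i) }

gbar : (ℕ → ℕ → ℤ × ℤ) → (k h : ℕ) (i : Fin 3) → RawHoop.Carrier (Aᵢ k h i)
gbar gsel k h f0 = gsel k h
gbar gsel k h (fs f0) = negΓ ℤ×ℤ-OAG (+ k , + h) (gsel k h)
gbar gsel k h (fs (fs f0)) = + h

-- Each x ∈ Ł_{j,1} is the value t_x(g) of a term at the generator g, and x is sent to the value of
-- t_x[R] ∨ E at ḡ for two fixed terms R and E.  For j ≥ 2, g = g_{j,1} = (a, b) is (1, 0): a linear
-- functional vanishing at the top divides, at g, its values on everything g generates, so a - j b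
-- divides 1, and with g ≤ ¬g only (1, 0) remains.
-- At a point v of a component Γ(ℤ ×ₗ ℤ, (k, h)) with v₁ < k, a high power of v is 0, which makes
-- ¬, ⊕ and n·_ of the MV-algebra term-definable; E compares j·v with the top and evaluates to 0 if
-- j v₁ = k and to the top otherwise.  Where E is the top the component map is constant.  Since P is
-- reduced, j v₁ = k forces k = j and v₁ = 1, and then R(v) = v ∧ ¬((j - 1) v) = (1, q) with jq ≤ h, so
-- the component map is the homomorphism (a, b) ↦ (a, q a + (h - j q) b); at g itself it is the
-- identity, which gives injectivity.  The remaining component, the coatom (1, -1) of Ł_{1,0}, only
-- generates elements (1, -c) and is sent to the top as well.  For j = 1 the same scheme works with
-- g = (0, 1), R = varₜ and E detecting v₁ ≥ 1.

module Submission where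

open import Defs
open import Data.Nat using (ℕ)
open import Data.Integer using (ℤ)
open import Data.Product using (_×_)
open import Data.List using (List)
open import Data.List.Membership.Propositional using (_∈_)

open import Data.Bool using (Bool; true; false; T; T?)
open import Data.Empty using (⊥-elim)
open import Data.Fin using () renaming (zero to f0; suc to fs)
open import Data.Integer.Base using (+_; 0ℤ; 1ℤ; -1ℤ; _+_; _*_; -_; _-_; _≤_; _<_; _≤ᵇ_; +≤+; +<+)
import Data.Integer.Base as ℤ
import Data.Integer.Divisibility.Signed as ℤ∣
import Data.Integer.Properties as ℤP
open import Data.Integer.Tactic.RingSolver using (solve-∀)
open import Data.List using (_∷_)
open import Data.List.Relation.Unary.Any using (here; there)
open import Data.Nat.Base using (z≤n; s≤s)
import Data.Nat as ℕ
open import Data.Nat.Coprimality using (Coprime)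
import Data.Nat.Coprimality as Cop
open import Data.Nat.Divisibility using (_∣_; ∣1⇒≡1; ∣-refl; ∣-trans; ∣-antisym; ∣⇒≤; 0∣⇒≡0)
import Data.Nat.Divisibility as ℕ∣
open import Data.Nat.ListAction using (sum)
import Data.Nat.Properties as ℕP
open import Data.Product using (Σ; _,_; proj₁; proj₂)
open import Data.Sum using (_⊎_; inj₁; inj₂)
open import Relation.Binary.Definitions using (tri<; tri≈; tri>)
open import Relation.Binary.PropositionalEquality hiding ([_])
open import Relation.Nullary using (¬_; yes; no)

-- All linear arithmetic goes through this: sum the hypotheses with ⟨+⟩ and close by a ring identity.
≤-by-slack : ∀ {A B L R : ℤ} (c : ℕ) → A ≤ B → R + A ≡ (L + B) + + c → L ≤ R
≤-by-slack {A} {B} {L} {R} c A≤B eq = ℤP.≤-trans (ℤP.≤-reflexive (cancel L A)) (ℤP.≤-trans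
  (ℤP.+-monoˡ-≤ (- A) (ℤP.≤-trans (ℤP.+-monoʳ-≤ L A≤B)
    (ℤP.≤-trans (ℤP.i≤i+j (L + B) (+ c)) (ℤP.≤-reflexive (sym eq)))))
  (ℤP.≤-reflexive (sym (cancel R A))))
  where
  cancel : ∀ x a → x ≡ (x + a) + - a
  cancel = solve-∀

infixl 6 _⟨+⟩_
_⟨+⟩_ : ∀ {a b c d} → a ≤ b → c ≤ d → a + c ≤ b + d
_⟨+⟩_ = ℤP.+-mono-≤

<⇒1+≤ : ∀ {a b} → a < b → 1ℤ + a ≤ b
<⇒1+≤ = ℤP.i<j⇒suc[i]≤j

1+≤⇒< : ∀ {a b} → 1ℤ + a ≤ b → a < b
1+≤⇒< = ℤP.suc[i]≤j⇒i<j

1ℤ≰0ℤ : ¬ (1ℤ ≤ 0ℤ)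
1ℤ≰0ℤ (+≤+ ())

0≤+ : ∀ n → 0ℤ ≤ + n
0≤+ n = +≤+ z≤n

-- The lexicographic group ℤ ×ₗ ℤ

ℤ² : Set
ℤ² = ℤ × ℤ

infixl 6 _+²_
_+²_ : ℤ² → ℤ² → ℤ²
x +² y = (proj₁ x + proj₁ y , proj₂ x + proj₂ y)

-²_ : ℤ² → ℤ²
-² x = (- proj₁ x , - proj₂ x)

0² : ℤ²
0² = (0ℤ , 0ℤ)

-- A record rather than T (lexLeq x y), so that x and y can be inferred from a proof.
infix 4 _≤ₗ_
record _≤ₗ_ (x y : ℤ²) : Set where
  constructor lex
  field unlex : T (lexLeq x y)
open _≤ₗ_ public

private
  T-≡true : ∀ {b} → b ≡ true → T b
  T-≡true refl = _

  ¬T-≡false : ∀ {b} → b ≡ false → ¬ T b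
  ¬T-≡false refl ()

<⇒≤ₗ : ∀ {a b c d} → a < c → (a , b) ≤ₗ (c , d)
<⇒≤ₗ {a} {b} {c} {d} a<c = lex (decide a<c)
  where
  decide : a < c → T (lexLeq (a , b) (c , d))
  decide a<c with c ≤ᵇ a in e
  ... | true = ⊥-elim (ℤP.<⇒≱ a<c (ℤP.≤ᵇ⇒≤ (T-≡true e)))
  ... | false = _

≤⇒≤ₗ : ∀ {a b d} → b ≤ d → (a , b) ≤ₗ (a , d)
≤⇒≤ₗ {a} {b} {d} b≤d = lex decide
  where
  decide : T (lexLeq (a , b) (a , d))
  decide with a ≤ᵇ a in e
  ... | true = ℤP.≤⇒≤ᵇ b≤d
  ... | false = ⊥-elim (¬T-≡false e (ℤP.≤⇒≤ᵇ (ℤP.≤-refl {a})))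

≤ₗ-cases : ∀ {a b c d} → (a , b) ≤ₗ (c , d) → a < c ⊎ (a ≡ c × b ≤ d)
≤ₗ-cases {a} {b} {c} {d} (lex t) = decide t
  where
  decide : T (lexLeq (a , b) (c , d)) → a < c ⊎ (a ≡ c × b ≤ d)
  decide t with c ≤ᵇ a in e₁ | a ≤ᵇ c in e₂ | b ≤ᵇ d in e₃
  ... | false | _ | _ = inj₁ (ℤP.≰⇒> (λ c≤a → ¬T-≡false e₁ (ℤP.≤⇒≤ᵇ c≤a)))
  ... | true | true | true =
    inj₂ (ℤP.≤-antisym (ℤP.≤ᵇ⇒≤ (T-≡true e₂)) (ℤP.≤ᵇ⇒≤ (T-≡true e₁)) ,
          ℤP.≤ᵇ⇒≤ (T-≡true e₃))

≤ₗ-refl : ∀ {x} → x ≤ₗ x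
≤ₗ-refl {x} = ≤⇒≤ₗ (ℤP.≤-refl {proj₂ x})

≤ₗ-reflexive : ∀ {x y} → x ≡ y → x ≤ₗ y
≤ₗ-reflexive refl = ≤ₗ-refl

≤ₗ-antisym : ∀ {x y} → x ≤ₗ y → y ≤ₗ x → x ≡ y
≤ₗ-antisym p q with ≤ₗ-cases p | ≤ₗ-cases q
... | inj₁ a<c | inj₁ c<a = ⊥-elim (ℤP.<-asym a<c c<a)
... | inj₁ a<c | inj₂ (refl , _) = ⊥-elim (ℤP.<-irrefl refl a<c)
... | inj₂ (refl , _) | inj₁ c<a = ⊥-elim (ℤP.<-irrefl refl c<a)
... | inj₂ (refl , b≤d) | inj₂ (_ , d≤b) = cong (_ ,_) (ℤP.≤-antisym b≤d d≤b)

≤ₗ-trans : ∀ {x y z} → x ≤ₗ y → y ≤ₗ z → x ≤ₗ z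
≤ₗ-trans p q with ≤ₗ-cases p | ≤ₗ-cases q
... | inj₁ a<c | inj₁ c<e = <⇒≤ₗ (ℤP.<-trans a<c c<e)
... | inj₁ a<c | inj₂ (refl , _) = <⇒≤ₗ a<c
... | inj₂ (refl , _) | inj₁ c<e = <⇒≤ₗ c<e
... | inj₂ (refl , b≤d) | inj₂ (refl , d≤f) = ≤⇒≤ₗ (ℤP.≤-trans b≤d d≤f)

≤ₗ-total : ∀ x y → x ≤ₗ y ⊎ y ≤ₗ x
≤ₗ-total (a , b) (c , d) with ℤP.<-cmp a c
... | tri< a<c _ _ = inj₁ (<⇒≤ₗ a<c)
... | tri> _ _ c<a = inj₂ (<⇒≤ₗ c<a)
... | tri≈ _ refl _ with ℤP.≤-total b d
...   | inj₁ b≤d = inj₁ (≤⇒≤ₗ b≤d)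
...   | inj₂ d≤b = inj₂ (≤⇒≤ₗ d≤b)

≤×≤⇒≤ₗ : ∀ {a b c d} → a ≤ c → b ≤ d → (a , b) ≤ₗ (c , d)
≤×≤⇒≤ₗ {a} {c = c} a≤c b≤d with ℤP.<-cmp a c
... | tri< a<c _ _ = <⇒≤ₗ a<c
... | tri≈ _ refl _ = ≤⇒≤ₗ b≤d
... | tri> _ _ c<a = ⊥-elim (ℤP.<⇒≱ c<a a≤c)

≤ₗ⇒proj₁-≤ : ∀ {x y} → x ≤ₗ y → proj₁ x ≤ proj₁ y
≤ₗ⇒proj₁-≤ p with ≤ₗ-cases p
... | inj₁ a<c = ℤP.<⇒≤ a<c
... | inj₂ (refl , _) = ℤP.≤-refl

+²-monoˡ-≤ₗ : ∀ w {x y} → x ≤ₗ y → x +² w ≤ₗ y +² w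
+²-monoˡ-≤ₗ (e , f) p with ≤ₗ-cases p
... | inj₁ a<c = <⇒≤ₗ (ℤP.+-monoˡ-< e a<c)
... | inj₂ (refl , b≤d) = ≤⇒≤ₗ (ℤP.+-monoˡ-≤ f b≤d)

module _ (A : OAG) where
  private
    _≤?_ : OAG.G A → OAG.G A → Bool
    _≤?_ = OAG._≤ᵇ_ A

  x≤y⇒maxG≡y : ∀ {x y} → T (x ≤? y) → maxG A x y ≡ y
  x≤y⇒maxG≡y {x} {y} t with x ≤? y
  ... | true = refl

  ≤-antisym⇒maxG≡x : ∀ {x y} → (T (x ≤? y) → x ≡ y) → maxG A x y ≡ x
  ≤-antisym⇒maxG≡x {x} {y} f with x ≤? y
  ... | true = sym (f _)
  ... | false = refl

  x≤y⇒minG≡x : ∀ {x y} → T (x ≤? y) → minG A x y ≡ x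
  x≤y⇒minG≡x {x} {y} t with x ≤? y
  ... | true = refl

  ≤-antisym⇒minG≡y : ∀ {x y} → (T (x ≤? y) → x ≡ y) → minG A x y ≡ y
  ≤-antisym⇒minG≡y {x} {y} f with x ≤? y
  ... | true = f _
  ... | false = refl

  maxG-idem : ∀ x → maxG A x x ≡ x
  maxG-idem x with x ≤? x
  ... | true = refl
  ... | false = refl

  minG-idem : ∀ x → minG A x x ≡ x
  minG-idem x with x ≤? x
  ... | true = refl
  ... | false = refl

infixl 7 _⊓ₗ_
infixl 6 _⊔ₗ_
_⊔ₗ_ _⊓ₗ_ : ℤ² → ℤ² → ℤ²
_⊔ₗ_ = maxG ℤ×ℤ-OAG
_⊓ₗ_ = minG ℤ×ℤ-OAG

x≤y⇒x⊔ₗy≡y : ∀ {x y} → x ≤ₗ y → x ⊔ₗ y ≡ y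
x≤y⇒x⊔ₗy≡y (lex t) = x≤y⇒maxG≡y ℤ×ℤ-OAG t

x≥y⇒x⊔ₗy≡x : ∀ {x y} → y ≤ₗ x → x ⊔ₗ y ≡ x
x≥y⇒x⊔ₗy≡x y≤x = ≤-antisym⇒maxG≡x ℤ×ℤ-OAG (λ t → ≤ₗ-antisym (lex t) y≤x)

x≤y⇒x⊓ₗy≡x : ∀ {x y} → x ≤ₗ y → x ⊓ₗ y ≡ x
x≤y⇒x⊓ₗy≡x (lex t) = x≤y⇒minG≡x ℤ×ℤ-OAG t

x≥y⇒x⊓ₗy≡y : ∀ {x y} → y ≤ₗ x → x ⊓ₗ y ≡ y
x≥y⇒x⊓ₗy≡y y≤x = ≤-antisym⇒minG≡y ℤ×ℤ-OAG (λ t → ≤ₗ-antisym (lex t) y≤x)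

⊔ₗ-sel : ∀ x y → x ⊔ₗ y ≡ x ⊎ x ⊔ₗ y ≡ y
⊔ₗ-sel x y with ≤ₗ-total x y
... | inj₁ x≤y = inj₂ (x≤y⇒x⊔ₗy≡y x≤y)
... | inj₂ y≤x = inj₁ (x≥y⇒x⊔ₗy≡x y≤x)

⊓ₗ-sel : ∀ x y → x ⊓ₗ y ≡ x ⊎ x ⊓ₗ y ≡ y
⊓ₗ-sel x y with ≤ₗ-total x y
... | inj₁ x≤y = inj₁ (x≤y⇒x⊓ₗy≡x x≤y)
... | inj₂ y≤x = inj₂ (x≥y⇒x⊓ₗy≡y y≤x)

+²-comm : ∀ x y → x +² y ≡ y +² x
+²-comm (a , b) (c , d) = cong₂ _,_ (ℤP.+-comm a c) (ℤP.+-comm b d)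

+²-assoc : ∀ x y z → x +² y +² z ≡ x +² (y +² z)
+²-assoc (a , b) (c , d) (e , f) = cong₂ _,_ (ℤP.+-assoc a c e) (ℤP.+-assoc b d f)

+²-identityʳ : ∀ x → x +² 0² ≡ x
+²-identityʳ (a , b) = cong₂ _,_ (ℤP.+-identityʳ a) (ℤP.+-identityʳ b)

+²-identityˡ : ∀ x → 0² +² x ≡ x
+²-identityˡ (a , b) = cong₂ _,_ (ℤP.+-identityˡ a) (ℤP.+-identityˡ b)

+²-inverseʳ : ∀ x → x +² -² x ≡ 0²
+²-inverseʳ (a , b) = cong₂ _,_ (ℤP.+-inverseʳ a) (ℤP.+-inverseʳ b)

x-y+y≡x : ∀ x y → x +² -² y +² y ≡ x
x-y+y≡x x y = trans (+²-assoc x (-² y) y)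
  (trans (cong (x +²_) (trans (+²-comm (-² y) y) (+²-inverseʳ y))) (+²-identityʳ x))

x+y-y≡x : ∀ x y → x +² y +² -² y ≡ x
x+y-y≡x x y = trans (+²-assoc x y (-² y)) (trans (cong (x +²_) (+²-inverseʳ y)) (+²-identityʳ x))

+²-monoʳ-≤ₗ : ∀ w {x y} → x ≤ₗ y → w +² x ≤ₗ w +² y
+²-monoʳ-≤ₗ w {x} {y} p = subst₂ _≤ₗ_ (+²-comm x w) (+²-comm y w) (+²-monoˡ-≤ₗ w p)

+²-mono-≤ₗ : ∀ {x x' y y'} → x ≤ₗ x' → y ≤ₗ y' → x +² y ≤ₗ x' +² y'
+²-mono-≤ₗ {x' = x'} {y} p q = ≤ₗ-trans (+²-monoˡ-≤ₗ y p) (+²-monoʳ-≤ₗ x' q)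

x≤y⇒0≤y-x : ∀ {x y} → x ≤ₗ y → 0² ≤ₗ y +² -² x
x≤y⇒0≤y-x {x} {y} p = subst (_≤ₗ y +² -² x) (+²-inverseʳ x) (+²-monoˡ-≤ₗ (-² x) p)

0≤x⇒y-x≤y : ∀ {x} y → 0² ≤ₗ x → y +² -² x ≤ₗ y
0≤x⇒y-x≤y {x} y p = subst₂ _≤ₗ_ (+²-identityʳ (y +² -² x)) (x-y+y≡x y x) (+²-monoʳ-≤ₗ (y +² -² x) p)

y≤x⊔ₗy : ∀ x y → y ≤ₗ x ⊔ₗ y
y≤x⊔ₗy x y with ≤ₗ-total x y
... | inj₁ x≤y = ≤ₗ-reflexive (sym (x≤y⇒x⊔ₗy≡y x≤y))
... | inj₂ y≤x = subst (y ≤ₗ_) (sym (x≥y⇒x⊔ₗy≡x y≤x)) y≤x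

x⊓ₗy≤y : ∀ x y → x ⊓ₗ y ≤ₗ y
x⊓ₗy≤y x y with ≤ₗ-total x y
... | inj₁ x≤y = subst (_≤ₗ y) (sym (x≤y⇒x⊓ₗy≡x x≤y)) x≤y
... | inj₂ y≤x = ≤ₗ-reflexive (x≥y⇒x⊓ₗy≡y y≤x)

-- Homomorphisms between algebras Γ(G, u)

record IsΓHom (A : OAG) (uA : OAG.G A) (B : OAG) (uB : OAG.G B) (φ : OAG.G A → OAG.G B) : Set where
  field
    ∨-hom : ∀ x y → φ (RawHoop._∨'_ (Γ A uA) x y) ≡ RawHoop._∨'_ (Γ B uB) (φ x) (φ y)
    ∧-hom : ∀ x y → φ (RawHoop._∧'_ (Γ A uA) x y) ≡ RawHoop._∧'_ (Γ B uB) (φ x) (φ y)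
    ·-hom : ∀ x y → φ (RawHoop._·_ (Γ A uA) x y) ≡ RawHoop._·_ (Γ B uB) (φ x) (φ y)
    ⇒-hom : ∀ x y → φ (RawHoop._⇒_ (Γ A uA) x y) ≡ RawHoop._⇒_ (Γ B uB) (φ x) (φ y)
    one-hom : φ uA ≡ uB

  eval-hom : ∀ t x → φ (eval (Γ A uA) t x) ≡ eval (Γ B uB) t (φ x)
  eval-hom varₜ x = refl
  eval-hom oneₜ x = one-hom
  eval-hom (s ∨ₜ t) x = trans (∨-hom _ _) (cong₂ (RawHoop._∨'_ (Γ B uB)) (eval-hom s x) (eval-hom t x))
  eval-hom (s ∧ₜ t) x = trans (∧-hom _ _) (cong₂ (RawHoop._∧'_ (Γ B uB)) (eval-hom s x) (eval-hom t x))
  eval-hom (s ·ₜ t) x = trans (·-hom _ _) (cong₂ (RawHoop._·_ (Γ B uB)) (eval-hom s x) (eval-hom t x))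
  eval-hom (s ⇒ₜ t) x = trans (⇒-hom _ _) (cong₂ (RawHoop._⇒_ (Γ B uB)) (eval-hom s x) (eval-hom t x))

∘-isΓHom : ∀ {A B C uA uB uC φ χ} → IsΓHom A uA B uB φ → IsΓHom B uB C uC χ →
           IsΓHom A uA C uC (λ x → χ (φ x))
∘-isΓHom {χ = χ} hφ hχ = record
  { ∨-hom = λ x y → trans (cong χ (∨-hom hφ x y)) (∨-hom hχ _ _)
  ; ∧-hom = λ x y → trans (cong χ (∧-hom hφ x y)) (∧-hom hχ _ _)
  ; ·-hom = λ x y → trans (cong χ (·-hom hφ x y)) (·-hom hχ _ _)
  ; ⇒-hom = λ x y → trans (cong χ (⇒-hom hφ x y)) (⇒-hom hχ _ _)
  ; one-hom = trans (cong χ (one-hom hφ)) (one-hom hχ) }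
  where open IsΓHom

module _ (A B : OAG) {uA : OAG.G A} {uB : OAG.G B} {φ : OAG.G A → OAG.G B}
  (totalA : ∀ x y → T (OAG._≤ᵇ_ A x y) ⊎ T (OAG._≤ᵇ_ A y x))
  (antisymB : ∀ x y → T (OAG._≤ᵇ_ B x y) → T (OAG._≤ᵇ_ B y x) → x ≡ y)
  (mono : ∀ x y → T (OAG._≤ᵇ_ A x y) → T (OAG._≤ᵇ_ B (φ x) (φ y)))
  (⊕-hom : ∀ x y → φ (OAG._⊕_ A x y) ≡ OAG._⊕_ B (φ x) (φ y))
  (⊖-hom : ∀ x → φ (OAG.⊖_ A x) ≡ OAG.⊖_ B (φ x))
  (o-hom : φ (OAG.o A) ≡ OAG.o B)
  (u-hom : φ uA ≡ uB) where

  private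
    maxG-hom : ∀ x y → φ (maxG A x y) ≡ maxG B (φ x) (φ y)
    maxG-hom x y with OAG._≤ᵇ_ A x y in e
    ... | true = sym (x≤y⇒maxG≡y B (mono x y (T-≡true e)))
    ... | false with totalA x y
    ...   | inj₁ t = ⊥-elim (¬T-≡false e t)
    ...   | inj₂ y≤x = sym (≤-antisym⇒maxG≡x B (λ t → antisymB _ _ t (mono y x y≤x)))

    minG-hom : ∀ x y → φ (minG A x y) ≡ minG B (φ x) (φ y)
    minG-hom x y with OAG._≤ᵇ_ A x y in e
    ... | true = sym (x≤y⇒minG≡x B (mono x y (T-≡true e)))
    ... | false with totalA x y
    ...   | inj₁ t = ⊥-elim (¬T-≡false e t)
    ...   | inj₂ y≤x = sym (≤-antisym⇒minG≡y B (λ t → antisymB _ _ t (mono y x y≤x)))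

  groupHom⇒isΓHom : IsΓHom A uA B uB φ
  groupHom⇒isΓHom = record
    { ∨-hom = maxG-hom
    ; ∧-hom = minG-hom
    ; ·-hom = λ x y → trans (maxG-hom _ _) (cong₂ (maxG B)
        (trans (⊕-hom _ _) (cong₂ (OAG._⊕_ B) (⊕-hom x y) (trans (⊖-hom uA) (cong (OAG.⊖_ B) u-hom)))) o-hom)
    ; ⇒-hom = λ x y → trans (minG-hom _ _) (cong₂ (minG B)
        (trans (⊕-hom _ _) (cong₂ (OAG._⊕_ B) (trans (⊕-hom _ _) (cong₂ (OAG._⊕_ B) u-hom (⊖-hom x))) refl)) u-hom)
    ; one-hom = u-hom }

private
  total² : ∀ x y → T (lexLeq x y) ⊎ T (lexLeq y x)
  total² x y with ≤ₗ-total x y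
  ... | inj₁ p = inj₁ (unlex p)
  ... | inj₂ p = inj₂ (unlex p)

  antisym² : ∀ x y → T (lexLeq x y) → T (lexLeq y x) → x ≡ y
  antisym² x y p q = ≤ₗ-antisym (lex p) (lex q)

  totalℤ : ∀ (x y : ℤ) → T (x ≤ᵇ y) ⊎ T (y ≤ᵇ x)
  totalℤ x y with ℤP.≤-total x y
  ... | inj₁ p = inj₁ (ℤP.≤⇒≤ᵇ p)
  ... | inj₂ p = inj₂ (ℤP.≤⇒≤ᵇ p)

  antisymℤ : ∀ (x y : ℤ) → T (x ≤ᵇ y) → T (y ≤ᵇ x) → x ≡ y
  antisymℤ x y p q = ℤP.≤-antisym (ℤP.≤ᵇ⇒≤ p) (ℤP.≤ᵇ⇒≤ q)

shear : ℤ → ℕ → ℤ² → ℤ²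
shear q s (a , b) = (a , q * a + + s * b)

shear-isΓHom : ∀ q s {uA uB} → shear q s uA ≡ uB → IsΓHom ℤ×ℤ-OAG uA ℤ×ℤ-OAG uB (shear q s)
shear-isΓHom q s = groupHom⇒isΓHom ℤ×ℤ-OAG ℤ×ℤ-OAG total² antisym² mono
  (λ x y → cong (_ ,_) (+-hom q (+ s) (proj₁ x) (proj₂ x) (proj₁ y) (proj₂ y)))
  (λ x → cong (_ ,_) (neg-hom q (+ s) (proj₁ x) (proj₂ x)))
  (cong (_ ,_) (zero-hom q (+ s)))
  where
  mono : ∀ x y → T (lexLeq x y) → T (lexLeq (shear q s x) (shear q s y))
  mono (a , b) (c , d) p with ≤ₗ-cases {a} {b} {c} {d} (lex p)
  ... | inj₁ a<c = unlex (<⇒≤ₗ {b = q * a + + s * b} {d = q * c + + s * d} a<c)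
  ... | inj₂ (refl , b≤d) = unlex (≤⇒≤ₗ {a} (ℤP.+-monoʳ-≤ (q * a) (ℤP.*-monoˡ-≤-nonNeg (+ s) b≤d)))
  +-hom : ∀ q s a b c d → q * (a + c) + s * (b + d) ≡ (q * a + s * b) + (q * c + s * d)
  +-hom = solve-∀
  neg-hom : ∀ q s a b → q * - a + s * - b ≡ - (q * a + s * b)
  neg-hom = solve-∀
  zero-hom : ∀ q s → q * 0ℤ + s * 0ℤ ≡ 0ℤ
  zero-hom = solve-∀

proj₁-isΓHom : ∀ {k h} → IsΓHom ℤ×ℤ-OAG (k , h) ℤ-OAG k proj₁
proj₁-isΓHom = groupHom⇒isΓHom ℤ×ℤ-OAG ℤ-OAG total² antisymℤ
  (λ x y p → ℤP.≤⇒≤ᵇ (≤ₗ⇒proj₁-≤ {x} {y} (lex p))) (λ _ _ → refl) (λ _ → refl) refl refl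

ι : ℤ → ℤ²
ι a = (a , 0ℤ)

ι-isΓHom : ∀ {k} → IsΓHom ℤ-OAG k ℤ×ℤ-OAG (k , 0ℤ) ι
ι-isΓHom = groupHom⇒isΓHom ℤ-OAG ℤ×ℤ-OAG totalℤ antisym² mono (λ _ _ → refl) (λ _ → refl) refl refl
  where
  mono : ∀ x y → T (x ≤ᵇ y) → T (lexLeq (ι x) (ι y))
  mono x y p with ℤP.<-cmp x y
  ... | tri< x<y _ _ = unlex (<⇒≤ₗ {b = 0ℤ} {d = 0ℤ} x<y)
  ... | tri≈ _ refl _ = unlex (≤ₗ-refl {ι x})
  ... | tri> _ _ y<x = ⊥-elim (ℤP.<⇒≱ y<x (ℤP.≤ᵇ⇒≤ p))

top·top≡top : ∀ {u} → 0² ≤ₗ u → RawHoop._·_ (Γ ℤ×ℤ-OAG u) u u ≡ u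
top·top≡top 0≤u = trans (cong (_⊔ₗ 0²) (cong₂ _,_ (u+u-u _) (u+u-u _))) (x≥y⇒x⊔ₗy≡x 0≤u)
  where
  u+u-u : ∀ a → (a + a) + - a ≡ a
  u+u-u = solve-∀

const-isΓHom : ∀ {uA uB} → 0² ≤ₗ uB → IsΓHom ℤ×ℤ-OAG uA ℤ×ℤ-OAG uB (λ _ → uB)
const-isΓHom {uB = uB} 0≤u = record
  { ∨-hom = λ _ _ → sym (maxG-idem ℤ×ℤ-OAG uB)
  ; ∧-hom = λ _ _ → sym (minG-idem ℤ×ℤ-OAG uB)
  ; ·-hom = λ _ _ → sym (top·top≡top 0≤u)
  ; ⇒-hom = λ _ _ → sym (trans (cong (_⊓ₗ uB) (cong₂ _,_ (u-u+u _) (u-u+u _))) (minG-idem ℤ×ℤ-OAG uB))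
  ; one-hom = refl }
  where
  u-u+u : ∀ a → (a + - a) + a ≡ a
  u-u+u = solve-∀

Γ² : ℤ² → RawHoop
Γ² = Γ ℤ×ℤ-OAG

InΓ : ℤ² → ℤ² → Set
InΓ u x = 0² ≤ₗ x × x ≤ₗ u

U⇒InΓ : ∀ {u} x → RawHoop.U (Γ² u) x → InΓ u x
U⇒InΓ _ (p , q) = lex p , lex q

InΓ⇒U : ∀ {u x} → InΓ u x → RawHoop.U (Γ² u) x
InΓ⇒U (p , q) = unlex p , unlex q

module _ {u : ℤ²} (0≤u : 0² ≤ₗ u) where
  open RawHoop (Γ² u) using (_·_; _⇒_)

  InΓ-⊔ₗ : ∀ {x y} → InΓ u x → InΓ u y → InΓ u (x ⊔ₗ y)
  InΓ-⊔ₗ {x} {y} x∈ y∈ with ⊔ₗ-sel x y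
  ... | inj₁ e = subst (InΓ u) (sym e) x∈
  ... | inj₂ e = subst (InΓ u) (sym e) y∈

  InΓ-⊓ₗ : ∀ {x y} → InΓ u x → InΓ u y → InΓ u (x ⊓ₗ y)
  InΓ-⊓ₗ {x} {y} x∈ y∈ with ⊓ₗ-sel x y
  ... | inj₁ e = subst (InΓ u) (sym e) x∈
  ... | inj₂ e = subst (InΓ u) (sym e) y∈

  InΓ-· : ∀ {x y} → InΓ u x → InΓ u y → InΓ u (x · y)
  InΓ-· {x} {y} (_ , x≤u) (_ , y≤u) = y≤x⊔ₗy _ 0² , ≤u
    where
    x+y-u≤x : x +² y +² -² u ≤ₗ x
    x+y-u≤x = subst (x +² y +² -² u ≤ₗ_) (x+y-y≡x x u) (+²-monoˡ-≤ₗ (-² u) (+²-monoʳ-≤ₗ x y≤u))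
    ≤u : (x +² y +² -² u) ⊔ₗ 0² ≤ₗ u
    ≤u with ⊔ₗ-sel (x +² y +² -² u) 0²
    ... | inj₁ e = subst (_≤ₗ u) (sym e) (≤ₗ-trans x+y-u≤x x≤u)
    ... | inj₂ e = subst (_≤ₗ u) (sym e) 0≤u

  InΓ-⇒ : ∀ {x y} → InΓ u x → InΓ u y → InΓ u (x ⇒ y)
  InΓ-⇒ {x} {y} (_ , x≤u) (0≤y , _) = 0≤ , x⊓ₗy≤y _ u
    where
    0≤u-x+y : 0² ≤ₗ u +² -² x +² y
    0≤u-x+y = subst (_≤ₗ u +² -² x +² y) (+²-identityʳ 0²) (+²-mono-≤ₗ (x≤y⇒0≤y-x x≤u) 0≤y)
    0≤ : 0² ≤ₗ (u +² -² x +² y) ⊓ₗ u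
    0≤ with ⊓ₗ-sel (u +² -² x +² y) u
    ... | inj₁ e = subst (0² ≤ₗ_) (sym e) 0≤u-x+y
    ... | inj₂ e = subst (0² ≤ₗ_) (sym e) 0≤u

  eval-InΓ : ∀ t {x} → InΓ u x → InΓ u (eval (Γ² u) t x)
  eval-InΓ varₜ x∈ = x∈
  eval-InΓ oneₜ x∈ = 0≤u , ≤ₗ-refl
  eval-InΓ (s ∨ₜ t) x∈ = InΓ-⊔ₗ (eval-InΓ s x∈) (eval-InΓ t x∈)
  eval-InΓ (s ∧ₜ t) x∈ = InΓ-⊓ₗ (eval-InΓ s x∈) (eval-InΓ t x∈)
  eval-InΓ (s ·ₜ t) x∈ = InΓ-· (eval-InΓ s x∈) (eval-InΓ t x∈)
  eval-InΓ (s ⇒ₜ t) x∈ = InΓ-⇒ (eval-InΓ s x∈) (eval-InΓ t x∈)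

negΓ≡u-x : ∀ u {x} → 0² ≤ₗ x → negΓ ℤ×ℤ-OAG u x ≡ u +² -² x
negΓ≡u-x u {x} 0≤x = trans (cong (_⊓ₗ u) (+²-identityʳ (u +² -² x))) (x≤y⇒x⊓ₗy≡x (0≤x⇒y-x≤y u 0≤x))

-- Generators of Γ(ℤ ×ₗ ℤ, u)

linear : ℤ → ℤ → ℤ² → ℤ
linear p q (a , b) = p * a + q * b

module _ {u g : ℤ²} (p q : ℤ) {d : ℤ} (d∣g : d ℤ∣.∣ linear p q g) (d∣u : d ℤ∣.∣ linear p q u) where

  private
    linear-+ : ∀ x y → linear p q (x +² y) ≡ linear p q x + linear p q y
    linear-+ (a , b) (c , e) = distrib p q a b c e
      where
      distrib : ∀ p q a b c e → p * (a + c) + q * (b + e) ≡ (p * a + q * b) + (p * c + q * e)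
      distrib = solve-∀

    linear-neg : ∀ x → linear p q (-² x) ≡ - linear p q x
    linear-neg (a , b) = distrib p q a b
      where
      distrib : ∀ p q a b → p * - a + q * - b ≡ - (p * a + q * b)
      distrib = solve-∀

    ∣-+ : ∀ {x y} → d ℤ∣.∣ linear p q x → d ℤ∣.∣ linear p q y → d ℤ∣.∣ linear p q (x +² y)
    ∣-+ {x} {y} d∣x d∣y = subst (d ℤ∣.∣_) (sym (linear-+ x y)) (ℤ∣.∣m∣n⇒∣m+n d∣x d∣y)

    ∣-neg : ∀ {x} → d ℤ∣.∣ linear p q x → d ℤ∣.∣ linear p q (-² x)
    ∣-neg {x} d∣x = subst (d ℤ∣.∣_) (sym (linear-neg x)) (ℤ∣.∣m⇒∣-m d∣x)

    ∣-0 : d ℤ∣.∣ linear p q 0²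
    ∣-0 = ℤ∣.divides 0ℤ (trans (cong₂ _+_ (ℤP.*-zeroʳ p) (ℤP.*-zeroʳ q)) (sym (ℤP.*-zeroˡ d)))

    ∣-⊔ₗ : ∀ {x y} → d ℤ∣.∣ linear p q x → d ℤ∣.∣ linear p q y → d ℤ∣.∣ linear p q (x ⊔ₗ y)
    ∣-⊔ₗ {x} {y} d∣x d∣y with ⊔ₗ-sel x y
    ... | inj₁ e = subst (λ z → d ℤ∣.∣ linear p q z) (sym e) d∣x
    ... | inj₂ e = subst (λ z → d ℤ∣.∣ linear p q z) (sym e) d∣y

    ∣-⊓ₗ : ∀ {x y} → d ℤ∣.∣ linear p q x → d ℤ∣.∣ linear p q y → d ℤ∣.∣ linear p q (x ⊓ₗ y)
    ∣-⊓ₗ {x} {y} d∣x d∣y with ⊓ₗ-sel x y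
    ... | inj₁ e = subst (λ z → d ℤ∣.∣ linear p q z) (sym e) d∣x
    ... | inj₂ e = subst (λ z → d ℤ∣.∣ linear p q z) (sym e) d∣y

  ∣-linear-eval : ∀ t → d ℤ∣.∣ linear p q (eval (Γ² u) t g)
  ∣-linear-eval varₜ = d∣g
  ∣-linear-eval oneₜ = d∣u
  ∣-linear-eval (s ∨ₜ t) = ∣-⊔ₗ (∣-linear-eval s) (∣-linear-eval t)
  ∣-linear-eval (s ∧ₜ t) = ∣-⊓ₗ (∣-linear-eval s) (∣-linear-eval t)
  ∣-linear-eval (s ·ₜ t) = ∣-⊔ₗ (∣-+ (∣-+ (∣-linear-eval s) (∣-linear-eval t)) (∣-neg d∣u)) ∣-0
  ∣-linear-eval (s ⇒ₜ t) = ∣-⊓ₗ (∣-+ (∣-+ d∣u (∣-neg (∣-linear-eval s))) (∣-linear-eval t)) d∣u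

  ∣-linear-generated : ∀ {x} → InGenerated (Γ² u) g x → d ℤ∣.∣ linear p q x
  ∣-linear-generated (t , refl) = ∣-linear-eval t

private
  ∣1⇒±1 : ∀ {d} → d ℤ∣.∣ 1ℤ → d ≡ 1ℤ ⊎ d ≡ -1ℤ
  ∣1⇒±1 {d} d∣1 with ∣1⇒≡1 (ℤ∣.∣⇒∣ᵤ d∣1)
  ∣1⇒±1 {+ .1} _ | refl = inj₁ refl
  ∣1⇒±1 {ℤ.-[1+ .0 ]} _ | refl = inj₂ refl

  e₁-generated : ∀ {k h g} → 2 ℕ.≤ k → IsGenerator (Ł₂ k h) g → InGenerated (Γ² (+ k , + h)) g (1ℤ , 0ℤ)
  e₁-generated {k} {h} 2≤k (_ , gen) =
    gen (1ℤ , 0ℤ) (InΓ⇒U (<⇒≤ₗ {b = 0ℤ} {d = 0ℤ} (+<+ (s≤s z≤n)) , <⇒≤ₗ {d = + h} (+<+ 2≤k)))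

generator⇒0<proj₁ : ∀ {k h g} → 2 ℕ.≤ k → IsGenerator (Ł₂ k h) g → 0ℤ < proj₁ g
generator⇒0<proj₁ {k} {h} {g@(a , b)} 2≤k gen with ℤP.<-cmp 0ℤ a
... | tri< 0<a _ _ = 0<a
... | tri> _ _ a<0 = ⊥-elim (ℤP.<⇒≱ a<0 (≤ₗ⇒proj₁-≤ (proj₁ (U⇒InΓ g (proj₁ gen)))))
... | tri≈ _ refl _ = ⊥-elim (ℕP.<⇒≢ 2≤k (sym (∣1⇒≡1 (ℤ∣.∣⇒∣ᵤ k∣1))))
  where
  k∣1 : + k ℤ∣.∣ 1ℤ * 1ℤ + 0ℤ * 0ℤ
  k∣1 = ∣-linear-generated {u = + k , + h} 1ℤ 0ℤ (ℤ∣.divides 0ℤ refl) (ℤ∣.divides 1ℤ k∣k)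
          (e₁-generated 2≤k gen)
    where
    k∣k : 1ℤ * + k + 0ℤ * + h ≡ 1ℤ * + k
    k∣k = trans (cong (_+_ (1ℤ * + k)) (ℤP.*-zeroˡ (+ h))) (ℤP.+-identityʳ _)

private
  ±1-bounds : ∀ {d} → d ≡ 1ℤ ⊎ d ≡ -1ℤ → -1ℤ ≤ d × d ≤ 1ℤ
  ±1-bounds (inj₁ refl) = ℤ.-≤+ , ℤP.≤-refl
  ±1-bounds (inj₂ refl) = ℤP.≤-refl , ℤ.-≤+

  a-j*0≡a : ∀ a j → a - j * 0ℤ ≡ a
  a-j*0≡a = solve-∀

  unit-generator-arith : ∀ {a b j : ℤ} → + 2 ≤ j → 0ℤ ≤ a → (a , b) ≤ₗ (j - a , 1ℤ - b) →
                         a - j * b ≡ 1ℤ ⊎ a - j * b ≡ -1ℤ → a ≡ 1ℤ × b ≡ 0ℤ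
  unit-generator-arith {a} {b} {j} 2≤j 0≤a g≤¬g ±1 with ℤP.<-cmp b 0ℤ
  ... | tri< b<0 _ _ = ⊥-elim (1ℤ≰0ℤ
          (≤-by-slack 0 (jb≤-j ⟨+⟩ proj₂ (±1-bounds ±1) ⟨+⟩ 0≤a ⟨+⟩ 2≤j) (identity a (j * b) j)))
    where
    jb≤-j : j * b ≤ j * -1ℤ
    jb≤-j = ℤP.*-monoˡ-≤-nonNeg j {{ℤ.nonNegative (ℤP.≤-trans (0≤+ 2) 2≤j)}} (ℤP.i<j⇒i≤pred[j] b<0)
    identity : ∀ a jb j → 0ℤ + (jb + (a - jb) + 0ℤ + + 2) ≡ 1ℤ + (j * -1ℤ + 1ℤ + a + j) + + 0
    identity = solve-∀
  ... | tri≈ _ refl _ = a≡1 (subst (λ d → d ≡ 1ℤ ⊎ d ≡ -1ℤ) (a-j*0≡a a j) ±1) , refl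
    where
    a≡1 : a ≡ 1ℤ ⊎ a ≡ -1ℤ → a ≡ 1ℤ
    a≡1 (inj₁ a≡1) = a≡1
    a≡1 (inj₂ a≡-1) = ⊥-elim (ℤP.<⇒≱ ℤ.-<+ (subst (0ℤ ≤_) a≡-1 0≤a))
  ... | tri> _ _ 0<b with ≤ₗ-cases g≤¬g
  ...   | inj₁ a<j-a = ⊥-elim (1ℤ≰0ℤ (≤-by-slack 0
            (j≤jb ⟨+⟩ j≤jb ⟨+⟩ -1≤d ⟨+⟩ -1≤d ⟨+⟩ <⇒1+≤ a<j-a ⟨+⟩ 2≤j)
            (identity a (j * b) j)))
    where
    -1≤d : -1ℤ ≤ a - j * b
    -1≤d = proj₁ (±1-bounds ±1)
    j≤jb : j * 1ℤ ≤ j * b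
    j≤jb = ℤP.*-monoˡ-≤-nonNeg j {{ℤ.nonNegative (ℤP.≤-trans (0≤+ 2) 2≤j)}} (<⇒1+≤ 0<b)
    identity : ∀ a jb j → 0ℤ + (j * 1ℤ + j * 1ℤ + -1ℤ + -1ℤ + (1ℤ + a) + + 2)
                         ≡ 1ℤ + (jb + jb + (a - jb) + (a - jb) + (j - a) + j) + + 0
    identity = solve-∀
  ...   | inj₂ (_ , b≤1-b) =
            ⊥-elim (1ℤ≰0ℤ (≤-by-slack 0 (<⇒1+≤ 0<b ⟨+⟩ b≤1-b ⟨+⟩ <⇒1+≤ 0<b) (identity b)))
    where
    identity : ∀ b → 0ℤ + (1ℤ + 0ℤ + b + (1ℤ + 0ℤ)) ≡ 1ℤ + (b + (1ℤ - b) + b) + + 0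
    identity = solve-∀

generator≤neg⇒≡e₁ : ∀ {j g} → 2 ℕ.≤ j → IsGenerator (Ł₂ j 1) g → g ≤ₗ negΓ ℤ×ℤ-OAG (+ j , 1ℤ) g →
                    g ≡ (1ℤ , 0ℤ)
generator≤neg⇒≡e₁ {j} {g@(a , b)} 2≤j gen g≤¬g =
  cong₂ _,_ (proj₁ a≡1∧b≡0) (proj₂ a≡1∧b≡0)
  where
  0≤g : 0² ≤ₗ g
  0≤g = proj₁ (U⇒InΓ g (proj₁ gen))
  d : ℤ
  d = a - + j * b
  linear≡d : linear 1ℤ (- + j) g ≡ d
  linear≡d = identity a b (+ j)
    where
    identity : ∀ a b j → 1ℤ * a + - j * b ≡ a - j * b
    identity = solve-∀
  d∣1 : d ℤ∣.∣ 1ℤ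
  d∣1 = subst (d ℤ∣.∣_) (identity (+ j))
          (∣-linear-generated {u = + j , 1ℤ} 1ℤ (- + j) (subst (d ℤ∣.∣_) (sym linear≡d) ℤ∣.∣-refl)
            (ℤ∣.divides 0ℤ (trans (u-identity (+ j)) (sym (ℤP.*-zeroˡ d)))) (e₁-generated 2≤j gen))
    where
    identity : ∀ j → 1ℤ * 1ℤ + - j * 0ℤ ≡ 1ℤ
    identity = solve-∀
    u-identity : ∀ j → 1ℤ * j + - j * 1ℤ ≡ 0ℤ
    u-identity = solve-∀
  a≡1∧b≡0 : a ≡ 1ℤ × b ≡ 0ℤ
  a≡1∧b≡0 = unit-generator-arith (+≤+ 2≤j) (≤ₗ⇒proj₁-≤ 0≤g) (subst (g ≤ₗ_) (negΓ≡u-x _ 0≤g) g≤¬g)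
              (∣1⇒±1 d∣1)

infixr 30 _^ₜ_
_^ₜ_ : Term → ℕ → Term
t ^ₜ ℕ.zero = oneₜ
t ^ₜ ℕ.suc n = t ·ₜ (t ^ₜ n)

infix 30 _[_]
_[_] : Term → Term → Term
varₜ [ r ] = r
oneₜ [ r ] = oneₜ
(s ∨ₜ t) [ r ] = s [ r ] ∨ₜ t [ r ]
(s ∧ₜ t) [ r ] = s [ r ] ∧ₜ t [ r ]
(s ·ₜ t) [ r ] = s [ r ] ·ₜ t [ r ]
(s ⇒ₜ t) [ r ] = s [ r ] ⇒ₜ t [ r ]

eval-[] : ∀ A t r x → eval A (t [ r ]) x ≡ eval A t (eval A r x)
eval-[] A varₜ r x = refl
eval-[] A oneₜ r x = refl
eval-[] A (s ∨ₜ t) r x = cong₂ (RawHoop._∨'_ A) (eval-[] A s r x) (eval-[] A t r x)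
eval-[] A (s ∧ₜ t) r x = cong₂ (RawHoop._∧'_ A) (eval-[] A s r x) (eval-[] A t r x)
eval-[] A (s ·ₜ t) r x = cong₂ (RawHoop._·_ A) (eval-[] A s r x) (eval-[] A t r x)
eval-[] A (s ⇒ₜ t) r x = cong₂ (RawHoop._⇒_ A) (eval-[] A s r x) (eval-[] A t r x)

-- For m beyond the first coordinate of the top, 𝟘 evaluates to 0 and the other terms below are the
-- MV-algebra operations ¬w = u - w, w ⊕ w' = (w + w') ⊓ u and n·w = (n w) ⊓ u.
module Terms (m : ℕ) where
  infix 27 ¬ₜ_
  infixr 25 _⊕ₜ_
  infixr 26 _×ₜ_

  𝟘 : Term
  𝟘 = varₜ ^ₜ m

  ¬ₜ_ : Term → Term
  ¬ₜ w = w ⇒ₜ 𝟘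

  _⊕ₜ_ : Term → Term → Term
  w ⊕ₜ w' = ¬ₜ w ⇒ₜ w'

  _×ₜ_ : ℕ → Term → Term
  ℕ.zero ×ₜ w = 𝟘
  ℕ.suc n ×ₜ w = w ⊕ₜ n ×ₜ w

  indicator : Term → Term
  indicator y = m ×ₜ y ·ₜ m ×ₜ y

  detector : ℕ → Term
  detector j₁ = indicator (j₁ ×ₜ varₜ ·ₜ varₜ) ∨ₜ indicator (¬ₜ (ℕ.suc j₁ ×ₜ varₜ))

  normaliser : ℕ → Term
  normaliser j₁ = varₜ ∧ₜ ¬ₜ (j₁ ×ₜ varₜ)

infixr 8 _⋆_
_⋆_ : ℕ → ℤ² → ℤ²
n ⋆ (a , b) = (+ n * a , + n * b)

⋆-suc : ∀ n x → ℕ.suc n ⋆ x ≡ x +² n ⋆ x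
⋆-suc n (a , b) = cong₂ _,_ (identity (+ n) a) (identity (+ n) b)
  where
  identity : ∀ n a → (1ℤ + n) * a ≡ a + n * a
  identity = solve-∀

module Evaluation (m : ℕ) {u v : ℤ²} (0≤u : 0² ≤ₗ u) (v∈ : InΓ u v)
                  (v₁<u₁ : proj₁ v < proj₁ u) (u₁<m : proj₁ u < + m) where
  open Terms m
  open RawHoop (Γ² u) using (_·_; _⇒_)

  K a : ℤ
  K = proj₁ u
  a = proj₁ v

  ev : Term → ℤ²
  ev t = eval (Γ² u) t v

  ev∈ : ∀ t → InΓ u (ev t)
  ev∈ t = eval-InΓ 0≤u t v∈

  private
    0≤a : 0ℤ ≤ a
    0≤a = ≤ₗ⇒proj₁-≤ (proj₁ v∈)

    0≤K : 0ℤ ≤ K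
    0≤K = ℤP.≤-trans 0≤a (ℤP.<⇒≤ v₁<u₁)

    v·≡0 : ∀ x → proj₁ v + proj₁ x + - K < 0ℤ → v · x ≡ 0²
    v·≡0 x neg = x≤y⇒x⊔ₗy≡y (<⇒≤ₗ neg)

    v·0≡0 : v · 0² ≡ 0²
    v·0≡0 = v·≡0 0² (1+≤⇒< (≤-by-slack 0 (<⇒1+≤ v₁<u₁) (identity a K)))
      where
      identity : ∀ a K → 0ℤ + (1ℤ + a) ≡ 1ℤ + (a + 0ℤ + - K) + K + + 0
      identity = solve-∀

    -- each factor v lowers the first coordinate by at least K - a ≥ 1, until 0 is reached
    pow-decreases : ∀ r → ev (varₜ ^ₜ r) ≡ 0² ⊎ proj₁ (ev (varₜ ^ₜ r)) + + r ≤ K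
    pow-decreases ℕ.zero = inj₂ (ℤP.≤-reflexive (ℤP.+-identityʳ K))
    pow-decreases (ℕ.suc r) with pow-decreases r
    ... | inj₁ ≡0 = inj₁ (trans (cong (v ·_) ≡0) v·0≡0)
    ... | inj₂ ≤K with ⊔ₗ-sel (v +² ev (varₜ ^ₜ r) +² -² u) 0²
    ...   | inj₂ e = inj₁ e
    ...   | inj₁ e = inj₂ (subst (λ y → proj₁ y + + ℕ.suc r ≤ K) (sym e)
                       (≤-by-slack 0 (<⇒1+≤ v₁<u₁ ⟨+⟩ ≤K) (identity a (proj₁ (ev (varₜ ^ₜ r))) K (+ r))))
      where
      identity : ∀ a x K r → K + (1ℤ + a + (x + r)) ≡ a + x + - K + (1ℤ + r) + (K + K) + + 0
      identity = solve-∀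

    pow-suc≡0 : ∀ r → K ≤ + r → ev (varₜ ^ₜ ℕ.suc r) ≡ 0²
    pow-suc≡0 r K≤r with pow-decreases r
    ... | inj₁ ≡0 = trans (cong (v ·_) ≡0) v·0≡0
    ... | inj₂ ≤K = v·≡0 _ (1+≤⇒< (≤-by-slack 0 (<⇒1+≤ v₁<u₁ ⟨+⟩ ≤K ⟨+⟩ K≤r)
                       (identity a (proj₁ (ev (varₜ ^ₜ r))) K (+ r))))
      where
      identity : ∀ a x K r → 0ℤ + (1ℤ + a + (x + r) + K) ≡ 1ℤ + (a + x + - K) + (K + K + r) + + 0
      identity = solve-∀

    pow≡0 : ∀ n → K < + n → ev (varₜ ^ₜ n) ≡ 0²
    pow≡0 ℕ.zero K<0 = ⊥-elim (ℤP.<⇒≱ K<0 0≤K)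
    pow≡0 (ℕ.suc r) (+<+ (s≤s K≤r)) = pow-suc≡0 r (+≤+ K≤r)

  ev-𝟘 : ev 𝟘 ≡ 0²
  ev-𝟘 = pow≡0 m u₁<m

  ev-¬ : ∀ w → ev (¬ₜ w) ≡ u +² -² ev w
  ev-¬ w = trans (cong (ev w ⇒_) ev-𝟘) (negΓ≡u-x u (proj₁ (ev∈ w)))

  ev-⊕ : ∀ w w' → ev (w ⊕ₜ w') ≡ (ev w +² ev w') ⊓ₗ u
  ev-⊕ w w' = trans (cong (_⇒ ev w') (ev-¬ w)) (cong (_⊓ₗ u) (cong₂ _,_
    (identity (proj₁ u) (proj₁ (ev w)) (proj₁ (ev w'))) (identity (proj₂ u) (proj₂ (ev w)) (proj₂ (ev w')))))
    where
    identity : ∀ u x y → u + - (u + - x) + y ≡ x + y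
    identity = solve-∀

  private
    ⊓ₗ-absorbs : ∀ {w} x → 0² ≤ₗ w → (w +² x ⊓ₗ u) ⊓ₗ u ≡ (w +² x) ⊓ₗ u
    ⊓ₗ-absorbs {w} x 0≤w with ≤ₗ-total x u
    ... | inj₁ x≤u = cong (λ y → (w +² y) ⊓ₗ u) (x≤y⇒x⊓ₗy≡x x≤u)
    ... | inj₂ u≤x = trans (cong (λ y → (w +² y) ⊓ₗ u) (x≥y⇒x⊓ₗy≡y u≤x))
                       (trans (x≥y⇒x⊓ₗy≡y (≤w+ u)) (sym (x≥y⇒x⊓ₗy≡y (≤ₗ-trans u≤x (≤w+ x)))))
      where
      ≤w+ : ∀ y → y ≤ₗ w +² y
      ≤w+ y = subst (_≤ₗ w +² y) (+²-identityˡ y) (+²-monoˡ-≤ₗ y 0≤w)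

  ev-× : ∀ n w → ev (n ×ₜ w) ≡ (n ⋆ ev w) ⊓ₗ u
  ev-× ℕ.zero w = trans ev-𝟘 (trans (sym (x≤y⇒x⊓ₗy≡x 0≤u))
                    (cong (_⊓ₗ u) (sym (cong₂ _,_ (ℤP.*-zeroˡ (proj₁ (ev w))) (ℤP.*-zeroˡ (proj₂ (ev w)))))))
  ev-× (ℕ.suc n) w = begin
    ev (w ⊕ₜ n ×ₜ w)               ≡⟨ ev-⊕ w (n ×ₜ w) ⟩
    (ev w +² ev (n ×ₜ w)) ⊓ₗ u     ≡⟨ cong (λ y → (ev w +² y) ⊓ₗ u) (ev-× n w) ⟩
    (ev w +² n ⋆ ev w ⊓ₗ u) ⊓ₗ u   ≡⟨ ⊓ₗ-absorbs (n ⋆ ev w) (proj₁ (ev∈ w)) ⟩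
    (ev w +² n ⋆ ev w) ⊓ₗ u        ≡⟨ cong (_⊓ₗ u) (sym (⋆-suc n (ev w))) ⟩
    (ℕ.suc n ⋆ ev w) ⊓ₗ u          ∎
    where open ≡-Reasoning

  ev-indicator-pos : ∀ y → 1ℤ ≤ proj₁ (ev y) → ev (indicator y) ≡ u
  ev-indicator-pos y 1≤y₁ = trans (cong₂ _·_ my≡u my≡u) (top·top≡top 0≤u)
    where
    my≡u : ev (m ×ₜ y) ≡ u
    my≡u = trans (ev-× m y) (x≥y⇒x⊓ₗy≡y (<⇒≤ₗ (ℤP.<-≤-trans u₁<m
             (subst (_≤ + m * proj₁ (ev y)) (ℤP.*-identityʳ (+ m)) (ℤP.*-monoˡ-≤-nonNeg (+ m) 1≤y₁)))))

  ev-indicator-zero : ∀ y → proj₁ (ev y) ≡ 0ℤ → 1ℤ ≤ K → ev (indicator y) ≡ 0²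
  ev-indicator-zero y y₁≡0 1≤K = trans (cong₂ _·_ my≡my my≡my) (x≤y⇒x⊔ₗy≡y (<⇒≤ₗ first<0))
    where
    my₁≡0 : + m * proj₁ (ev y) ≡ 0ℤ
    my₁≡0 = trans (cong (+ m *_) y₁≡0) (ℤP.*-zeroʳ (+ m))
    my≡my : ev (m ×ₜ y) ≡ m ⋆ ev y
    my≡my = trans (ev-× m y) (x≤y⇒x⊓ₗy≡x (<⇒≤ₗ (subst (_< K) (sym my₁≡0) (1+≤⇒< 1≤K))))
    first<0 : + m * proj₁ (ev y) + + m * proj₁ (ev y) + - K < 0ℤ
    first<0 rewrite my₁≡0 = 1+≤⇒< (≤-by-slack 0 1≤K (identity K))
      where
      identity : ∀ K → 0ℤ + 1ℤ ≡ 1ℤ + (0ℤ + 0ℤ + - K) + K + + 0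
      identity = solve-∀

  module _ (j₁ : ℕ) where
    private
      j : ℕ
      j = ℕ.suc j₁
      y₁ y₂ : Term
      y₁ = j₁ ×ₜ varₜ ·ₜ varₜ
      y₂ = ¬ₜ (j ×ₜ varₜ)

      ⊔ₗ-top : ∀ x → InΓ u x → x ⊔ₗ u ≡ u × u ⊔ₗ x ≡ u
      ⊔ₗ-top x (_ , x≤u) = x≤y⇒x⊔ₗy≡y x≤u , x≥y⇒x⊔ₗy≡x x≤u

      1≤ja⇒1≤a : 1ℤ ≤ + j * a → 1ℤ ≤ a
      1≤ja⇒1≤a 1≤ja with ℤP.<-cmp 0ℤ a
      ... | tri< 0<a _ _ = <⇒1+≤ 0<a
      ... | tri≈ _ refl _ = ⊥-elim (1ℤ≰0ℤ (subst (1ℤ ≤_) (ℤP.*-zeroʳ (+ j)) 1≤ja))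
      ... | tri> _ _ a<0 = ⊥-elim (ℤP.<⇒≱ a<0 0≤a)

      y₁-pos : K < + j * a → 1ℤ ≤ proj₁ (ev y₁)
      y₁-pos K<ja =
        subst (λ y → 1ℤ ≤ proj₁ y) (sym (x≥y⇒x⊔ₗy≡x {inner} {0²} (<⇒≤ₗ (1+≤⇒< 1≤inner)))) 1≤inner
        where
        inner : ℤ²
        inner = ev (j₁ ×ₜ varₜ) +² v +² -² u
        1≤inner : 1ℤ ≤ proj₁ inner
        1≤inner with ≤ₗ-total (j₁ ⋆ v) u
        ... | inj₁ j₁v≤u rewrite ev-× j₁ varₜ | x≤y⇒x⊓ₗy≡x j₁v≤u =
              ≤-by-slack 0 (<⇒1+≤ K<ja) (identity a K (+ j₁))
          where
          identity : ∀ a K j₁ → j₁ * a + a + - K + (1ℤ + K) ≡ 1ℤ + (1ℤ + j₁) * a + + 0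
          identity = solve-∀
        ... | inj₂ u≤j₁v rewrite ev-× j₁ varₜ | x≥y⇒x⊓ₗy≡y u≤j₁v =
              ≤-by-slack 0 (1≤ja⇒1≤a (<⇒1+≤ (ℤP.≤-<-trans 0≤K K<ja))) (identity a K)
          where
          identity : ∀ a K → K + a + - K + 1ℤ ≡ 1ℤ + a + + 0
          identity = solve-∀

      y₂-pos : + j * a < K → 1ℤ ≤ proj₁ (ev y₂)
      y₂-pos ja<K rewrite ev-¬ (j ×ₜ varₜ) | ev-× j varₜ
                        | x≤y⇒x⊓ₗy≡x (<⇒≤ₗ {b = + j * proj₂ v} {d = proj₂ u} ja<K) =
        ≤-by-slack 0 (<⇒1+≤ ja<K) (identity K (+ j * a))
        where
        identity : ∀ K ja → K + - ja + (1ℤ + ja) ≡ 1ℤ + K + + 0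
        identity = solve-∀

      module Near (ja≡K : + j * a ≡ K) (1≤K : 1ℤ ≤ K) where
        1≤a : 1ℤ ≤ a
        1≤a = 1≤ja⇒1≤a (subst (1ℤ ≤_) (sym ja≡K) 1≤K)

        j₁v<u : j₁ ⋆ v ≤ₗ u
        j₁v<u = <⇒≤ₗ (1+≤⇒< (≤-by-slack 0 1≤a (trans (cong (_+ 1ℤ) (sym ja≡K)) (identity a (+ j₁)))))
          where
          identity : ∀ a j₁ → (1ℤ + j₁) * a + 1ℤ ≡ 1ℤ + j₁ * a + a + + 0
          identity = solve-∀

        y₁-zero : proj₁ (ev y₁) ≡ 0ℤ
        y₁-zero with ⊔ₗ-sel (ev (j₁ ×ₜ varₜ) +² v +² -² u) 0²
        ... | inj₂ e = cong proj₁ e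
        ... | inj₁ e rewrite e | ev-× j₁ varₜ | x≤y⇒x⊓ₗy≡x j₁v<u =
              trans (cong (λ K → + j₁ * a + a + - K) (sym ja≡K)) (identity a (+ j₁))
          where
          identity : ∀ a j₁ → j₁ * a + a + - ((1ℤ + j₁) * a) ≡ 0ℤ
          identity = solve-∀

        y₂-zero : proj₁ (ev y₂) ≡ 0ℤ
        y₂-zero = begin
          proj₁ (ev y₂)                    ≡⟨ cong proj₁ (ev-¬ (j ×ₜ varₜ)) ⟩
          K + - proj₁ (ev (j ×ₜ varₜ))      ≡⟨ cong (λ x → K + - proj₁ x) (ev-× j varₜ) ⟩
          K + - proj₁ ((j ⋆ v) ⊓ₗ u)        ≡⟨ cong (λ x → K + - x) jv⊓u₁≡K ⟩
          K + - K                          ≡⟨ ℤP.+-inverseʳ K ⟩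
          0ℤ                               ∎
          where
          open ≡-Reasoning
          jv⊓u₁≡K : proj₁ ((j ⋆ v) ⊓ₗ u) ≡ K
          jv⊓u₁≡K with ⊓ₗ-sel (j ⋆ v) u
          ... | inj₁ e = trans (cong proj₁ e) ja≡K
          ... | inj₂ e = cong proj₁ e

    ev-detector-far : + j * a ≢ K → ev (detector j₁) ≡ u
    ev-detector-far ja≢K with ℤP.<-cmp (+ j * a) K
    ... | tri< ja<K _ _ = trans (cong (ev (indicator y₁) ⊔ₗ_) (ev-indicator-pos y₂ (y₂-pos ja<K)))
                                (proj₁ (⊔ₗ-top _ (ev∈ (indicator y₁))))
    ... | tri≈ _ ja≡K _ = ⊥-elim (ja≢K ja≡K)
    ... | tri> _ _ K<ja = trans (cong (_⊔ₗ ev (indicator y₂)) (ev-indicator-pos y₁ (y₁-pos K<ja)))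
                                (proj₂ (⊔ₗ-top _ (ev∈ (indicator y₂))))

    ev-detector-near : + j * a ≡ K → 1ℤ ≤ K → ev (detector j₁) ≡ 0²
    ev-detector-near ja≡K 1≤K = trans (cong₂ _⊔ₗ_ (ev-indicator-zero y₁ (Near.y₁-zero ja≡K 1≤K) 1≤K)
                                                  (ev-indicator-zero y₂ (Near.y₂-zero ja≡K 1≤K) 1≤K))
                                      (maxG-idem ℤ×ℤ-OAG 0²)

    ev-normaliser : ev (normaliser j₁) ≡ v ⊓ₗ (u +² -² ((j₁ ⋆ v) ⊓ₗ u))
    ev-normaliser = cong (v ⊓ₗ_) (trans (ev-¬ (j₁ ×ₜ varₜ)) (cong (λ y → u +² -² y) (ev-× j₁ varₜ)))

HomomorphicAt : ℤ² → (ℤ² → Term) → ℤ² → ℤ² → Set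
HomomorphicAt uS F u v =
  Σ (ℤ² → ℤ²) λ φ →
    IsΓHom ℤ×ℤ-OAG uS ℤ×ℤ-OAG u φ × (∀ x → InΓ uS x → eval (Γ² u) (F x) v ≡ φ x)

module _ {u : ℤ²} (0≤u : 0² ≤ₗ u) {v : ℤ²} (v∈ : InΓ u v) (r e : Term) where

  ev-far : eval (Γ² u) e v ≡ u → ∀ t → eval (Γ² u) (t [ r ] ∨ₜ e) v ≡ u
  ev-far e≡u t = trans (cong (eval (Γ² u) (t [ r ]) v ⊔ₗ_) e≡u)
                       (x≤y⇒x⊔ₗy≡y (proj₂ (eval-InΓ 0≤u (t [ r ]) v∈)))

  ev-near : eval (Γ² u) e v ≡ 0² → ∀ t → eval (Γ² u) (t [ r ] ∨ₜ e) v ≡ eval (Γ² u) t (eval (Γ² u) r v)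
  ev-near e≡0 t = trans (cong (eval (Γ² u) (t [ r ]) v ⊔ₗ_) e≡0)
    (trans (x≥y⇒x⊔ₗy≡x (proj₁ (eval-InΓ 0≤u (t [ r ]) v∈))) (eval-[] (Γ² u) t r v))

  module _ {uS : ℤ²} (term : ℤ² → Term) {F : ℤ² → Term} (F≡ : ∀ x → F x ≡ term x [ r ] ∨ₜ e) where
    private
      unfold : ∀ x → eval (Γ² u) (F x) v ≡ eval (Γ² u) (term x [ r ] ∨ₜ e) v
      unfold x = cong (λ t → eval (Γ² u) t v) (F≡ x)

    far⇒homomorphicAt : eval (Γ² u) e v ≡ u → HomomorphicAt uS F u v
    far⇒homomorphicAt e≡u = (λ _ → u) , const-isΓHom 0≤u , λ x _ → trans (unfold x) (ev-far e≡u (term x))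

    near⇒homomorphicAt : ∀ {γ φ} → (∀ x → InΓ uS x → eval (Γ² uS) (term x) γ ≡ x) →
                         IsΓHom ℤ×ℤ-OAG uS ℤ×ℤ-OAG u φ → eval (Γ² u) r v ≡ φ γ →
                         eval (Γ² u) e v ≡ 0² → HomomorphicAt uS F u v
    near⇒homomorphicAt {γ} {φ} represents φ-hom r≡φγ e≡0 = φ , φ-hom , λ x x∈ → begin
      eval (Γ² u) (F x) v                      ≡⟨ unfold x ⟩
      eval (Γ² u) (term x [ r ] ∨ₜ e) v        ≡⟨ ev-near e≡0 (term x) ⟩
      eval (Γ² u) (term x) (eval (Γ² u) r v)   ≡⟨ cong (eval (Γ² u) (term x)) r≡φγ ⟩
      eval (Γ² u) (term x) (φ γ)               ≡⟨ sym (IsΓHom.eval-hom φ-hom (term x) γ) ⟩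
      φ (eval (Γ² uS) (term x) γ)              ≡⟨ cong φ (represents x x∈) ⟩
      φ x                                      ∎
      where open ≡-Reasoning

-- representative x is junk (varₜ) outside the universe.
module Representatives {uS γ : ℤ²} (gen : ∀ y → RawHoop.U (Γ² uS) y → InGenerated (Γ² uS) γ y) where
  representative : ℤ² → Term
  representative x with T? (lexLeq 0² x) | T? (lexLeq x uS)
  ... | yes p | yes q = proj₁ (gen x (p , q))
  ... | _ | _ = varₜ

  represents : ∀ x → InΓ uS x → eval (Γ² uS) (representative x) γ ≡ x
  represents x (lex p , lex q) with T? (lexLeq 0² x) | T? (lexLeq x uS)
  ... | yes p' | yes q' = sym (proj₂ (gen x (p' , q')))
  ... | no ¬p | _ = ⊥-elim (¬p p)
  ... | yes _ | no ¬q = ⊥-elim (¬q q)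

-- The subalgebra of Ł_{1,0} generated by its coatom (1, -1)

count : Term → ℕ
count varₜ = 1
count oneₜ = 0
count (s ∨ₜ t) = count s ℕ.⊓ count t
count (s ∧ₜ t) = count s ℕ.⊔ count t
count (s ·ₜ t) = count s ℕ.+ count t
count (s ⇒ₜ t) = count t ℕ.∸ count s

top-minus : ℕ → ℤ²
top-minus c = (1ℤ , - + c)

eval-top-minus : ∀ t → eval (Ł₂ 1 0) t (top-minus 1) ≡ top-minus (count t)
eval-top-minus varₜ = refl
eval-top-minus oneₜ = refl
eval-top-minus (s ∨ₜ t) rewrite eval-top-minus s | eval-top-minus t with ℕP.≤-total (count s) (count t)
... | inj₁ c≤d = trans (x≥y⇒x⊔ₗy≡x (≤⇒≤ₗ (ℤP.neg-mono-≤ (+≤+ c≤d))))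
                     (cong top-minus (sym (ℕP.m≤n⇒m⊓n≡m c≤d)))
... | inj₂ d≤c = trans (x≤y⇒x⊔ₗy≡y (≤⇒≤ₗ (ℤP.neg-mono-≤ (+≤+ d≤c))))
                     (cong top-minus (sym (ℕP.m≥n⇒m⊓n≡n d≤c)))
eval-top-minus (s ∧ₜ t) rewrite eval-top-minus s | eval-top-minus t with ℕP.≤-total (count s) (count t)
... | inj₁ c≤d = trans (x≥y⇒x⊓ₗy≡y (≤⇒≤ₗ (ℤP.neg-mono-≤ (+≤+ c≤d))))
                     (cong top-minus (sym (ℕP.m≤n⇒m⊔n≡n c≤d)))
... | inj₂ d≤c = trans (x≤y⇒x⊓ₗy≡x (≤⇒≤ₗ (ℤP.neg-mono-≤ (+≤+ d≤c))))
                     (cong top-minus (sym (ℕP.m≥n⇒m⊔n≡m d≤c)))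
eval-top-minus (s ·ₜ t) rewrite eval-top-minus s | eval-top-minus t =
  trans (x≥y⇒x⊔ₗy≡x {y = 0²} (<⇒≤ₗ (+<+ (s≤s z≤n)))) (cong (1ℤ ,_) (identity (+ count s) (+ count t)))
  where
  identity : ∀ c d → (- c + - d) + - 0ℤ ≡ - (c + d)
  identity = solve-∀
eval-top-minus (s ⇒ₜ t) rewrite eval-top-minus s | eval-top-minus t with ℕP.≤-total (count s) (count t)
... | inj₁ c≤d = trans (x≤y⇒x⊓ₗy≡x (≤⇒≤ₗ (subst (_≤ 0ℤ) (sym second≡) (ℤP.neg-mono-≤ (0≤+ _)))))
                       (cong (1ℤ ,_) second≡)
  where
  second≡ : 0ℤ + - - + count s + - + count t ≡ - + (count t ℕ.∸ count s)
  second≡ = trans (identity (+ count s) (+ count t)) (trans (ℤP.m-n≡m⊖n (count s) (count t)) (ℤP.⊖-≤ c≤d))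
    where
    identity : ∀ c d → 0ℤ + - - c + - d ≡ c + - d
    identity = solve-∀
... | inj₂ d≤c = trans (x≥y⇒x⊓ₗy≡y (≤⇒≤ₗ (subst (0ℤ ≤_) (sym second≡) (0≤+ _))))
                       (cong top-minus (sym (ℕP.m≤n⇒m∸n≡0 d≤c)))
  where
  second≡ : 0ℤ + - - + count s + - + count t ≡ + (count s ℕ.∸ count t)
  second≡ = trans (identity (+ count s) (+ count t)) (trans (ℤP.m-n≡m⊖n (count s) (count t)) (ℤP.⊖-≥ d≤c))
    where
    identity : ∀ c d → 0ℤ + - - c + - d ≡ c + - d
    identity = solve-∀

module _ (m : ℕ) where
  open Terms m

  count-^ : ∀ n → count (varₜ ^ₜ n) ≡ n
  count-^ ℕ.zero = refl
  count-^ (ℕ.suc n) = cong ℕ.suc (count-^ n)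

  count-× : ∀ n w → count (n ×ₜ w) ≡ m ℕ.∸ n ℕ.* (m ℕ.∸ count w)
  count-× ℕ.zero w = count-^ m
  count-× (ℕ.suc n) w = begin
    count (n ×ₜ w) ℕ.∸ (count 𝟘 ℕ.∸ count w)
      ≡⟨ cong₂ (λ x y → x ℕ.∸ (y ℕ.∸ count w)) (count-× n w) (count-^ m) ⟩
    m ℕ.∸ n ℕ.* d ℕ.∸ d                           ≡⟨ ℕP.∸-+-assoc m (n ℕ.* d) d ⟩
    m ℕ.∸ (n ℕ.* d ℕ.+ d)                         ≡⟨ cong (m ℕ.∸_) (ℕP.+-comm (n ℕ.* d) d) ⟩
    m ℕ.∸ ℕ.suc n ℕ.* d                           ∎
    where
    open ≡-Reasoning
    d : ℕ
    d = m ℕ.∸ count w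

  count-indicator : ∀ y → count y ℕ.< m → count (indicator y) ≡ 0
  count-indicator y y<m = cong₂ ℕ._+_ m×y≡0 m×y≡0
    where
    m×y≡0 : count (m ×ₜ y) ≡ 0
    m×y≡0 = trans (count-× m y)
      (ℕP.m≤n⇒m∸n≡0 (ℕP.m≤m*n m (m ℕ.∸ count y) {{ℕ.>-nonZero (ℕP.m<n⇒0<n∸m y<m)}}))

  count-detector : ∀ j₁ → 1 ℕ.≤ j₁ → 3 ℕ.≤ m → count (detector j₁) ≡ 0
  count-detector j₁ 1≤j₁ 3≤m = cong (ℕ._⊓ count (indicator (¬ₜ (ℕ.suc j₁ ×ₜ varₜ))))
    (count-indicator (j₁ ×ₜ varₜ ·ₜ varₜ) (ℕP.≤-<-trans (ℕP.+-monoˡ-≤ 1 count-j₁×var≤1) 3≤m))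
    where
    count-j₁×var≤1 : count (j₁ ×ₜ varₜ) ℕ.≤ 1
    count-j₁×var≤1 = begin
      count (j₁ ×ₜ varₜ)                   ≡⟨ count-× j₁ varₜ ⟩
      m ℕ.∸ j₁ ℕ.* (m ℕ.∸ 1)
        ≤⟨ ℕP.∸-monoʳ-≤ m (ℕP.m≤n*m (m ℕ.∸ 1) j₁ {{ℕ.>-nonZero 1≤j₁}}) ⟩
      m ℕ.∸ (m ℕ.∸ 1)                      ≡⟨ ℕP.m∸[m∸n]≡n (ℕP.≤-trans (s≤s z≤n) 3≤m) ⟩
      1                                    ∎
      where open ℕP.≤-Reasoning

  count-embedding : ∀ t r e → count e ≡ 0 → count (t [ r ] ∨ₜ e) ≡ 0
  count-embedding t r e e≡0 = trans (cong (count (t [ r ]) ℕ.⊓_) e≡0) (ℕP.⊓-zeroʳ (count (t [ r ])))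

record PreservesOps (A B : RawHoop) (f : RawHoop.Carrier A → RawHoop.Carrier B) : Set where
  open RawHoop A using (U)
  field
    ∨-pres : ∀ x y → U x → U y → RawHoop._≈_ B (f (RawHoop._∨'_ A x y)) (RawHoop._∨'_ B (f x) (f y))
    ∧-pres : ∀ x y → U x → U y → RawHoop._≈_ B (f (RawHoop._∧'_ A x y)) (RawHoop._∧'_ B (f x) (f y))
    ·-pres : ∀ x y → U x → U y → RawHoop._≈_ B (f (RawHoop._·_ A x y)) (RawHoop._·_ B (f x) (f y))
    ⇒-pres : ∀ x y → U x → U y → RawHoop._≈_ B (f (RawHoop._⇒_ A x y)) (RawHoop._⇒_ B (f x) (f y))
    one-pres : RawHoop._≈_ B (f (RawHoop.one A)) (RawHoop.one B)

agrees⇒preservesOps : ∀ {uS B uB φ} {f : ℤ² → OAG.G B} → 0² ≤ₗ uS → IsΓHom ℤ×ℤ-OAG uS B uB φ →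
                      (∀ x → InΓ uS x → f x ≡ φ x) → PreservesOps (Γ² uS) (Γ B uB) f
agrees⇒preservesOps {uS} {B} {uB} {φ} {f} 0≤uS φ-hom f≈φ = record
  { ∨-pres = λ x y x∈ y∈ → lift ΓB._∨'_ (∨-hom x y) (InΓ-⊔ₗ 0≤uS (U⇒InΓ x x∈) (U⇒InΓ y y∈)) x∈ y∈
  ; ∧-pres = λ x y x∈ y∈ → lift ΓB._∧'_ (∧-hom x y) (InΓ-⊓ₗ 0≤uS (U⇒InΓ x x∈) (U⇒InΓ y y∈)) x∈ y∈
  ; ·-pres = λ x y x∈ y∈ → lift ΓB._·_ (·-hom x y) (InΓ-· 0≤uS (U⇒InΓ x x∈) (U⇒InΓ y y∈)) x∈ y∈
  ; ⇒-pres = λ x y x∈ y∈ → lift ΓB._⇒_ (⇒-hom x y) (InΓ-⇒ 0≤uS (U⇒InΓ x x∈) (U⇒InΓ y y∈)) x∈ y∈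
  ; one-pres = trans (f≈φ uS (0≤uS , ≤ₗ-refl)) one-hom }
  where
  open IsΓHom φ-hom
  module ΓB = RawHoop (Γ B uB)
  lift : ∀ (_∙_ : OAG.G B → OAG.G B → OAG.G B) {z x y} → φ z ≡ φ x ∙ φ y → InΓ uS z →
         RawHoop.U (Γ² uS) x → RawHoop.U (Γ² uS) y → f z ≡ f x ∙ f y
  lift _∙_ {z} {x} {y} hom z∈ x∈ y∈ =
    trans (f≈φ z z∈) (trans hom (sym (cong₂ _∙_ (f≈φ x (U⇒InΓ x x∈)) (f≈φ y (U⇒InΓ y y∈)))))

homomorphicAt⇒preservesOps : ∀ {uS F u v} → 0² ≤ₗ uS → HomomorphicAt uS F u v →
                             PreservesOps (Γ² uS) (Γ² u) (λ x → eval (Γ² u) (F x) v)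
homomorphicAt⇒preservesOps 0≤uS (φ , φ-hom , agrees) = agrees⇒preservesOps 0≤uS φ-hom agrees

-- Components in Ł_k are read off Ł_{k,0} through ι and proj₁.
homomorphicAt-ι⇒preservesOps : ∀ {uS F k a} → 0² ≤ₗ uS → HomomorphicAt uS F (k , 0ℤ) (ι a) →
                               PreservesOps (Γ² uS) (Γ ℤ-OAG k) (λ x → eval (Γ ℤ-OAG k) (F x) a)
homomorphicAt-ι⇒preservesOps {F = F} {k} {a} 0≤uS (φ , φ-hom , agrees) =
  agrees⇒preservesOps 0≤uS (∘-isΓHom φ-hom proj₁-isΓHom) λ x x∈ →
    trans (cong proj₁ (IsΓHom.eval-hom ι-isΓHom (F x) a)) (cong proj₁ (agrees x x∈))

private
  ≡⇒≈ᵢ : ∀ {k h} i {x y} → x ≡ y → RawHoop._≈_ (Aᵢ k h i) x y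
  ≡⇒≈ᵢ f0 e = e
  ≡⇒≈ᵢ (fs f0) e = e
  ≡⇒≈ᵢ (fs (fs f0)) e = e

  eval-A-Δ : ∀ I J t g k h i → eval (A-Δ I J) t g k h i ≡ eval (Aᵢ k h i) t (g k h i)
  eval-A-Δ I J varₜ g k h i = refl
  eval-A-Δ I J oneₜ g k h i = refl
  eval-A-Δ I J (s ∨ₜ t) g k h i = cong₂ (RawHoop._∨'_ (Aᵢ k h i)) (eval-A-Δ I J s g k h i) (eval-A-Δ I J t g k h i)
  eval-A-Δ I J (s ∧ₜ t) g k h i = cong₂ (RawHoop._∧'_ (Aᵢ k h i)) (eval-A-Δ I J s g k h i) (eval-A-Δ I J t g k h i)
  eval-A-Δ I J (s ·ₜ t) g k h i = cong₂ (RawHoop._·_ (Aᵢ k h i)) (eval-A-Δ I J s g k h i) (eval-A-Δ I J t g k h i)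
  eval-A-Δ I J (s ⇒ₜ t) g k h i = cong₂ (RawHoop._⇒_ (Aᵢ k h i)) (eval-A-Δ I J s g k h i) (eval-A-Δ I J t g k h i)

module _ (I J : List ℕ) (ḡ : RawHoop.Carrier (A-Δ I J)) (A : RawHoop) (F : RawHoop.Carrier A → Term) where
  open RawHoop A using (U; _≈_)

  evalΔ : RawHoop.Carrier A → RawHoop.Carrier (A-Δ I J)
  evalΔ x k h i = eval (Aᵢ k h i) (F x) (ḡ k h i)

  componentwise⇒embeddable : (∀ k h i → InΔ I J k h i → PreservesOps A (Aᵢ k h i) (λ x → evalΔ x k h i)) →
                             (∀ x y → U x → U y → RawHoop._≈_ (A-Δ I J) (evalΔ x) (evalΔ y) → x ≈ y) →
                             EmbeddableInGenerated A (A-Δ I J) ḡ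
  componentwise⇒embeddable pres inj = evalΔ ,
    (λ x _ → F x , λ k h i _ → ≡⇒≈ᵢ i (sym (eval-A-Δ I J (F x) ḡ k h i))) ,
    (λ x y x∈ y∈ k h i d → ∨-pres (pres k h i d) x y x∈ y∈) ,
    (λ x y x∈ y∈ k h i d → ∧-pres (pres k h i d) x y x∈ y∈) ,
    (λ x y x∈ y∈ k h i d → ·-pres (pres k h i d) x y x∈ y∈) ,
    (λ x y x∈ y∈ k h i d → ⇒-pres (pres k h i d) x y x∈ y∈) ,
    (λ k h i d → one-pres (pres k h i d)) ,
    inj
    where open PreservesOps

private
  ∈⇒≤sum : ∀ {n ns} → n ∈ ns → n ℕ.≤ sum ns
  ∈⇒≤sum {n} {_ ∷ ns} (here refl) = ℕP.m≤m+n n (sum ns)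
  ∈⇒≤sum {n} {x ∷ _} (there n∈) = ℕP.≤-trans (∈⇒≤sum n∈) (ℕP.m≤n+m _ x)

∈↓-bounds : ∀ {k X} → (∀ {n} → n ∈ X → 0 ℕ.< n) → k ∈↓ X → 1 ℕ.≤ k × k ℕ.≤ sum X
∈↓-bounds {ℕ.zero} pos (n , n∈X , 0∣n) = ⊥-elim (ℕP.<-irrefl (sym (0∣⇒≡0 0∣n)) (pos n∈X))
∈↓-bounds {ℕ.suc k} pos (n , n∈X , k∣n) =
  s≤s z≤n , ℕP.≤-trans (∣⇒≤ {{ℕ.>-nonZero (pos n∈X)}} k∣n) (∈⇒≤sum n∈X)

coprime⇒1≤ : ∀ {k h} → 2 ℕ.≤ k → Coprime k h → 1 ℕ.≤ h
coprime⇒1≤ {h = ℕ.zero} 2≤k cop = ⊥-elim (ℕP.<⇒≢ 2≤k (sym (cop (∣-refl , ℕ∣.divides 0 refl))))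
coprime⇒1≤ {h = ℕ.suc _} _ _ = s≤s z≤n

coprime-multiple : ∀ {j k h} → Coprime k h → j ℕ.* h ≡ k → k ≡ j × h ≡ 1
coprime-multiple {j} {k} {h} cop jh≡k = trans (sym jh≡k) (trans (cong (j ℕ.*_) h≡1) (ℕP.*-identityʳ j)) , h≡1
  where
  h≡1 : h ≡ 1
  h≡1 = cop (ℕ∣.divides j (sym jh≡k) , ∣-refl)

module _ {I J} (P : ReducedPresentation I J) where
  open ReducedPresentation P

  -- A multiple of j ∈ J lying in J↓ divides some n ∈ J; as j divides n too, n = j.
  multiple∈J↓ : ∀ {j k c} → j ∈ J → k ∈↓ J → j ℕ.* c ≡ k → k ≡ j × c ≡ 1
  multiple∈J↓ {j} {k} {c} j∈J (n , n∈J , k∣n) jc≡k = k≡j , c≡1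
    where
    j∣k : j ∣ k
    j∣k = ℕ∣.divides c (trans (sym jc≡k) (ℕP.*-comm j c))
    n≡j : n ≡ j
    n≡j with n ℕ.≟ j
    ... | yes n≡j = n≡j
    ... | no n≢j = ⊥-elim (J-J j∈J n∈J n≢j (∣-trans j∣k k∣n))
    k≡j : k ≡ j
    k≡j = ∣-antisym (subst (k ∣_) n≡j k∣n) j∣k
    c≡1 : c ≡ 1
    c≡1 = ℕP.*-cancelˡ-≡ c 1 j {{ℕ.>-nonZero (J-pos j∈J)}} (trans jc≡k (trans k≡j (sym (ℕP.*-identityʳ j))))

  bound : ℕ
  bound = ℕ.suc (sum I ℕ.+ sum J)

  ∈↓I⇒<bound : ∀ {k} → k ∈↓ I → 1 ℕ.≤ k × k ℕ.< bound
  ∈↓I⇒<bound k∈ with ∈↓-bounds I-pos k∈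
  ... | 1≤k , k≤ΣI = 1≤k , s≤s (ℕP.≤-trans k≤ΣI (ℕP.m≤m+n (sum I) (sum J)))

  ∈↓J⇒<bound : ∀ {k} → k ∈↓ J → 1 ℕ.≤ k × k ℕ.< bound
  ∈↓J⇒<bound k∈ with ∈↓-bounds J-pos k∈
  ... | 1≤k , k≤ΣJ = 1≤k , s≤s (ℕP.≤-trans k≤ΣJ (ℕP.m≤n+m (sum J) (sum I)))

  J↓≡1 : ∀ {k} → 1 ∈ J → k ∈↓ J → k ≡ 1
  J↓≡1 1∈J (n , n∈J , k∣n) = proj₁ (multiple∈J↓ 1∈J (n , n∈J , k∣n) (ℕP.*-identityˡ _))

-- The embedding of Ł_{j,1} for j ≥ 2

private
  ⊓ₗ-same-first : ∀ a b c → (a , b) ⊓ₗ (a , c) ≡ (a , b ℤ.⊓ c)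
  ⊓ₗ-same-first a b c with ℤP.≤-total b c
  ... | inj₁ b≤c = trans (x≤y⇒x⊓ₗy≡x (≤⇒≤ₗ b≤c)) (cong (a ,_) (sym (ℤP.i≤j⇒i⊓j≡i b≤c)))
  ... | inj₂ c≤b = trans (x≥y⇒x⊓ₗy≡y (≤⇒≤ₗ c≤b)) (cong (a ,_) (sym (ℤP.i≥j⇒i⊓j≡j c≤b)))

  near-scale : ∀ j₁ h b → (1ℤ + + j₁) * (b ℤ.⊓ (h - + j₁ * b)) ≤ h
  near-scale j₁ h b with ℤP.≤-total b (h - + j₁ * b)
  ... | inj₁ b≤ rewrite ℤP.i≤j⇒i⊓j≡i b≤ = ≤-by-slack 0 b≤ (identity (+ j₁) h b)
    where
    identity : ∀ j₁ h b → h + b ≡ (1ℤ + j₁) * b + (h - j₁ * b) + + 0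
    identity = solve-∀
  ... | inj₂ ≤b rewrite ℤP.i≥j⇒i⊓j≡j ≤b =
    ≤-by-slack 0 (ℤP.*-monoˡ-≤-nonNeg (+ j₁) ≤b) (identity (+ j₁) h b)
    where
    identity : ∀ j₁ h b → h + j₁ * (h - j₁ * b) ≡ (1ℤ + j₁) * (h - j₁ * b) + j₁ * b + + 0
    identity = solve-∀

module LargeJ (m j₁ : ℕ) (1≤j₁ : 1 ℕ.≤ j₁) (j<m : ℕ.suc j₁ ℕ.< m) (term : ℤ² → Term)
              (represents : ∀ x → InΓ (+ ℕ.suc j₁ , 1ℤ) x →
                            eval (Ł₂ (ℕ.suc j₁) 1) (term x) (1ℤ , 0ℤ) ≡ x) where
  open Terms m

  j : ℕ
  j = ℕ.suc j₁

  opaque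
    F : ℤ² → Term
    F x = term x [ normaliser j₁ ] ∨ₜ detector j₁

    F-unfold : ∀ x → F x ≡ term x [ normaliser j₁ ] ∨ₜ detector j₁
    F-unfold x = refl

  far : ∀ {k h v} → 1 ℕ.≤ k → k ℕ.< m → InΓ (+ k , + h) v → proj₁ v < + k → + j * proj₁ v ≢ + k →
        HomomorphicAt (+ j , 1ℤ) F (+ k , + h) v
  far {k} {h} 1≤k k<m v∈ v₁<k ja≢k = far⇒homomorphicAt 0≤u v∈ (normaliser j₁) (detector j₁) term F-unfold
    (Evaluation.ev-detector-far m 0≤u v∈ v₁<k (+<+ k<m) j₁ ja≢k)
    where
    0≤u : 0² ≤ₗ (+ k , + h)
    0≤u = <⇒≤ₗ (+<+ 1≤k)

  module NearPoint (h : ℕ) (b : ℤ) where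
    u v : ℤ²
    u = (+ j , + h)
    v = (1ℤ , b)

    0≤u : 0² ≤ₗ u
    0≤u = <⇒≤ₗ (+<+ (s≤s z≤n))

    v∈ : InΓ u v
    v∈ = <⇒≤ₗ (+<+ (s≤s z≤n)) , <⇒≤ₗ (+<+ (s≤s 1≤j₁))

    open Evaluation m 0≤u v∈ (+<+ (s≤s 1≤j₁)) (+<+ j<m)

    q : ℤ
    q = b ℤ.⊓ (+ h - + j₁ * b)

    ev-R : ev (normaliser j₁) ≡ (1ℤ , q)
    ev-R = begin
      ev (normaliser j₁)               ≡⟨ ev-normaliser j₁ ⟩
      v ⊓ₗ (u +² -² ((j₁ ⋆ v) ⊓ₗ u))    ≡⟨ cong (λ y → v ⊓ₗ (u +² -² y)) (x≤y⇒x⊓ₗy≡x j₁v≤u) ⟩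
      v ⊓ₗ (u +² -² (j₁ ⋆ v))           ≡⟨ cong (λ c → v ⊓ₗ (c , + h - + j₁ * b)) (identity (+ j₁)) ⟩
      v ⊓ₗ (1ℤ , + h - + j₁ * b)        ≡⟨ ⊓ₗ-same-first 1ℤ b (+ h - + j₁ * b) ⟩
      (1ℤ , q)                         ∎
      where
      open ≡-Reasoning
      j₁v≤u : j₁ ⋆ v ≤ₗ u
      j₁v≤u = <⇒≤ₗ (subst (_< + j) (sym (ℤP.*-identityʳ (+ j₁))) (+<+ (ℕP.n<1+n j₁)))
      identity : ∀ j₁ → 1ℤ + j₁ + - (j₁ * 1ℤ) ≡ 1ℤ
      identity = solve-∀

    ev-E : ev (detector j₁) ≡ 0²
    ev-E = ev-detector-near j₁ (ℤP.*-identityʳ (+ j)) (+≤+ (s≤s z≤n))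

    homomorphicAt : HomomorphicAt (+ j , 1ℤ) F u v
    homomorphicAt = near⇒homomorphicAt 0≤u v∈ (normaliser j₁) (detector j₁) term F-unfold represents
                      (shear-isΓHom q s shear-u) shear-e₁ ev-E
      where
      d : ℤ
      d = + h - + j * q
      0≤d : 0ℤ ≤ d
      0≤d = ℤP.i≤j⇒0≤j-i (near-scale j₁ (+ h) b)
      s : ℕ
      s = ℤ.∣ d ∣
      shear-u : shear q s (+ j , 1ℤ) ≡ u
      shear-u = cong (+ j ,_)
        (trans (cong (λ z → q * + j + z * 1ℤ) (ℤP.0≤i⇒+∣i∣≡i 0≤d)) (identity q (+ j) (+ h)))
        where
        identity : ∀ q j h → q * j + (h - j * q) * 1ℤ ≡ h
        identity = solve-∀
      shear-e₁ : ev (normaliser j₁) ≡ shear q s (1ℤ , 0ℤ)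
      shear-e₁ = trans ev-R (cong (1ℤ ,_) (sym (identity q (+ s))))
        where
        identity : ∀ q s → q * 1ℤ + s * 0ℤ ≡ q
        identity = solve-∀

  near : ∀ h b → HomomorphicAt (+ j , 1ℤ) F (+ j , + h) (1ℤ , b)
  near h b = NearPoint.homomorphicAt h b

  at-e₁ : ∀ x → InΓ (+ j , 1ℤ) x → eval (Ł₂ j 1) (F x) (1ℤ , 0ℤ) ≡ x
  at-e₁ x x∈ = trans (cong (λ t → eval (Ł₂ j 1) t (1ℤ , 0ℤ)) (F-unfold x))
                 (trans (ev-near 0≤u v∈ (normaliser j₁) (detector j₁) ev-E (term x))
                 (trans (cong (eval (Ł₂ j 1) (term x)) (trans ev-R (cong (1ℤ ,_) 0⊓1≡0))) (represents x x∈)))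
    where
    open NearPoint 1 0ℤ
    0⊓1≡0 : q ≡ 0ℤ
    0⊓1≡0 = ℤP.i≤j⇒i⊓j≡i (subst (0ℤ ≤_) (sym (cong (λ z → 1ℤ - z) (ℤP.*-zeroʳ (+ j₁)))) (0≤+ 1))

  at-coatom : ∀ x → eval (Ł₂ 1 0) (F x) (top-minus 1) ≡ (1ℤ , 0ℤ)
  at-coatom x = trans (eval-top-minus (F x)) (cong top-minus (trans (cong count (F-unfold x))
    (count-embedding m (term x) (normaliser j₁) (detector j₁) (count-detector m j₁ 1≤j₁ 3≤m))))
    where
    3≤m : 3 ℕ.≤ m
    3≤m = ℕP.≤-trans (s≤s (s≤s 1≤j₁)) j<m

  far-or-near : ∀ {k h v} → 1 ℕ.≤ k → k ℕ.< m → InΓ (+ k , + h) v → proj₁ v < + k →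
                (+ j * proj₁ v ≡ + k → k ≡ j × proj₁ v ≡ 1ℤ) → HomomorphicAt (+ j , 1ℤ) F (+ k , + h) v
  far-or-near {k} {h} {v} 1≤k k<m v∈ v₁<k near-only-at-j with + j * proj₁ v ℤP.≟ + k
  ... | no ja≢k = far 1≤k k<m v∈ v₁<k ja≢k
  ... | yes ja≡k with near-only-at-j ja≡k
  ...   | refl , v₁≡1 =
    subst (HomomorphicAt (+ j , 1ℤ) F (+ j , + h)) (cong (_, proj₂ v) (sym v₁≡1)) (near h (proj₂ v))

module LargeJEmbedding {I J} (P : ReducedPresentation I J) {gsel} (sel : IsGenSelection gsel)
                       {j₁} (1≤j₁ : 1 ℕ.≤ j₁) (j∈J : ℕ.suc j₁ ∈ J) where
  open ReducedPresentation P

  private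
    j : ℕ
    j = ℕ.suc j₁

    cop-j1 : Coprime j 1
    cop-j1 = Cop.sym (Cop.1-coprimeTo j)

    g-j1 : IsGenerator (Ł₂ j 1) (gsel j 1) × T (lexLeq (gsel j 1) (negΓ ℤ×ℤ-OAG (+ j , + 1) (gsel j 1)))
    g-j1 = proj₁ sel j 1 (s≤s 1≤j₁) (s≤s z≤n) (s≤s 1≤j₁) cop-j1

    γ≡e₁ : gsel j 1 ≡ (1ℤ , 0ℤ)
    γ≡e₁ = generator≤neg⇒≡e₁ (s≤s 1≤j₁) (proj₁ g-j1) (lex (proj₂ g-j1))

  open Representatives (proj₂ (proj₁ g-j1))
  open LargeJ (bound P) j₁ 1≤j₁ (proj₂ (∈↓J⇒<bound P (j , j∈J , ∣-refl))) representative
              (λ x x∈ → subst (λ γ → eval (Ł₂ j 1) (representative x) γ ≡ x) γ≡e₁ (represents x x∈))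
    hiding (j)

  private
    embedding : ℤ² → RawHoop.Carrier (A-Δ I J)
    embedding = evalΔ I J (gbar gsel) (Ł₂ j 1) F

    0≤u : 0² ≤ₗ (+ j , 1ℤ)
    0≤u = <⇒≤ₗ (+<+ (s≤s z≤n))

    near-only-at-j : ∀ {a k} → 0ℤ ≤ a → (∀ {c} → + c ≡ a → j ℕ.* c ≡ k → k ≡ j × c ≡ 1) →
                     + j * a ≡ + k → k ≡ j × a ≡ 1ℤ
    near-only-at-j {+ c} _ multiple ja≡k with multiple refl (ℤP.+-injective (trans (ℤP.pos-* j c) ja≡k))
    ... | k≡j , c≡1 = k≡j , cong +_ c≡1

    module Generator {k h} (2≤k : 2 ℕ.≤ k) (k∈ : k ∈↓ J) (h<k : h ℕ.< k) (cop : Coprime k h) where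
      g : ℤ²
      g = gsel k h
      sel-g : IsGenerator (Ł₂ k h) g × T (lexLeq g (negΓ ℤ×ℤ-OAG (+ k , + h) g))
      sel-g = proj₁ sel k h 2≤k (coprime⇒1≤ 2≤k cop) h<k cop
      g∈ : InΓ (+ k , + h) g
      g∈ = U⇒InΓ g (proj₁ (proj₁ sel-g))
      1≤a : 1ℤ ≤ proj₁ g
      1≤a = <⇒1+≤ (generator⇒0<proj₁ 2≤k (proj₁ sel-g))
      g≤¬g : g ≤ₗ (+ k , + h) +² -² g
      g≤¬g = subst (g ≤ₗ_) (negΓ≡u-x (+ k , + h) (proj₁ g∈)) (lex (proj₂ sel-g))
      a<k : proj₁ g < + k
      a<k = 1+≤⇒< (≤-by-slack 0 (1≤a ⟨+⟩ ≤ₗ⇒proj₁-≤ g≤¬g) (identity (proj₁ g) (+ k)))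
        where
        identity : ∀ a k → k + (1ℤ + a) ≡ 1ℤ + a + (a + (k - a)) + + 0
        identity = solve-∀
      multiple : ∀ {c} → j ℕ.* c ≡ k → k ≡ j × c ≡ 1
      multiple = multiple∈J↓ P j∈J k∈

    homomorphicAt-g : ∀ k h → InΔ I J k h f0 → HomomorphicAt (+ j , 1ℤ) F (+ k , + h) (gsel k h)
    homomorphicAt-g 0 _ (k∈ , _) = ⊥-elim (ℕP.n≮0 (proj₁ (∈↓J⇒<bound P k∈)))
    homomorphicAt-g 1 (ℕ.suc _) (_ , s≤s () , _)
    homomorphicAt-g 1 0 (k∈ , _) = subst (HomomorphicAt (+ j , 1ℤ) F (1ℤ , 0ℤ)) (sym (proj₂ sel))
      (far (s≤s z≤n) (proj₂ (∈↓J⇒<bound P k∈)) (≤⇒≤ₗ (0≤+ 1) , <⇒≤ₗ (+<+ (s≤s z≤n)))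
           (+<+ (s≤s z≤n)) (λ j0≡1 → 1ℤ≰0ℤ (ℤP.≤-reflexive (trans (sym j0≡1) (ℤP.*-zeroʳ (+ j))))))
    homomorphicAt-g k@(ℕ.suc (ℕ.suc _)) h (k∈ , h<k , cop) =
      far-or-near (s≤s z≤n) (proj₂ (∈↓J⇒<bound P k∈)) g∈ a<k
                  (near-only-at-j (ℤP.≤-trans (0≤+ 1) 1≤a) (λ _ → multiple))
      where open Generator (s≤s (s≤s z≤n)) k∈ h<k cop

    homomorphicAt-¬g : ∀ k h → InΔ I J k h (fs f0) →
                       HomomorphicAt (+ j , 1ℤ) F (+ k , + h) (negΓ ℤ×ℤ-OAG (+ k , + h) (gsel k h))
    homomorphicAt-¬g 0 _ (k∈ , _) = ⊥-elim (ℕP.n≮0 (proj₁ (∈↓J⇒<bound P k∈)))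
    homomorphicAt-¬g 1 (ℕ.suc _) (_ , s≤s () , _)
    homomorphicAt-¬g 1 0 _ =
      subst (λ g → HomomorphicAt (+ j , 1ℤ) F (1ℤ , 0ℤ) (negΓ ℤ×ℤ-OAG (1ℤ , 0ℤ) g)) (sym (proj₂ sel))
      ((λ _ → (1ℤ , 0ℤ)) , const-isΓHom (<⇒≤ₗ (+<+ (s≤s z≤n))) , λ x _ → at-coatom x)
    homomorphicAt-¬g k@(ℕ.suc (ℕ.suc _)) h (k∈ , h<k , cop) =
      subst (HomomorphicAt (+ j , 1ℤ) F (+ k , + h)) (sym (negΓ≡u-x (+ k , + h) (proj₁ g∈)))
        (far-or-near (s≤s z≤n) (proj₂ (∈↓J⇒<bound P k∈)) (0≤u-g , 0≤x⇒y-x≤y _ (proj₁ g∈)) k-a<k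
                     (near-only-at-j (≤ₗ⇒proj₁-≤ 0≤u-g) (λ _ → multiple)))
      where
      open Generator (s≤s (s≤s z≤n)) k∈ h<k cop
      0≤u-g : 0² ≤ₗ (+ k , + h) +² -² g
      0≤u-g = x≤y⇒0≤y-x (proj₂ g∈)
      k-a<k : + k + - proj₁ g < + k
      k-a<k = 1+≤⇒< (≤-by-slack 0 1≤a (identity (proj₁ g) (+ k)))
        where
        identity : ∀ a k → k + 1ℤ ≡ 1ℤ + (k + - a) + a + + 0
        identity = solve-∀

    homomorphicAt-h : ∀ k h → InΔ I J k h (fs (fs f0)) → HomomorphicAt (+ j , 1ℤ) F (+ k , 0ℤ) (ι (+ h))
    homomorphicAt-h k h (k∈ , h<k , cop) = far-or-near (proj₁ (∈↓I⇒<bound P k∈)) (proj₂ (∈↓I⇒<bound P k∈))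
      (≤×≤⇒≤ₗ (0≤+ h) ℤP.≤-refl , <⇒≤ₗ (+<+ h<k)) (+<+ h<k)
      (near-only-at-j (0≤+ h) λ { refl → coprime-multiple cop })

    components : ∀ k h i → InΔ I J k h i → PreservesOps (Ł₂ j 1) (Aᵢ k h i) (λ x → embedding x k h i)
    components k h f0 d = homomorphicAt⇒preservesOps {F = F} {v = gbar gsel k h f0} 0≤u (homomorphicAt-g k h d)
    components k h (fs f0) d =
      homomorphicAt⇒preservesOps {F = F} {v = gbar gsel k h (fs f0)} 0≤u (homomorphicAt-¬g k h d)
    components k h (fs (fs f0)) d = homomorphicAt-ι⇒preservesOps {F = F} {a = + h} 0≤u (homomorphicAt-h k h d)

    injective : ∀ x y → RawHoop.U (Ł₂ j 1) x → RawHoop.U (Ł₂ j 1) y →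
                RawHoop._≈_ (A-Δ I J) (embedding x) (embedding y) → x ≡ y
    injective x y x∈ y∈ eq =
      trans (sym (at-γ x (U⇒InΓ x x∈)))
            (trans (eq j 1 f0 ((j , j∈J , ∣-refl) , s≤s 1≤j₁ , cop-j1)) (at-γ y (U⇒InΓ y y∈)))
      where
      at-γ : ∀ x → InΓ (+ j , 1ℤ) x → eval (Ł₂ j 1) (F x) (gsel j 1) ≡ x
      at-γ x x∈ = trans (cong (eval (Ł₂ j 1) (F x)) γ≡e₁) (at-e₁ x x∈)

  embeddable : EmbeddableInGenerated (Ł₂ j 1) (A-Δ I J) (gbar gsel)
  embeddable = componentwise⇒embeddable I J (gbar gsel) (Ł₂ j 1) F components injective

-- The embedding of Ł_{1,1}

private
  γ₁ : ℤ²
  γ₁ = (0ℤ , 1ℤ)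

  -- γ₁ ·ₜ γ₁ = 0 and γ₁ ⇒ 0 = (1, 0), whose powers are the (1, -n); their negations are the (0, n + 1).
  ε : Term
  ε = varₜ ⇒ₜ (varₜ ·ₜ varₜ)

  ev-ε^ : ∀ n → eval (Ł₂ 1 1) (ε ^ₜ ℕ.suc n) γ₁ ≡ (1ℤ , - + n)
  ev-ε^ ℕ.zero = refl
  ev-ε^ (ℕ.suc n) rewrite ev-ε^ n =
    trans (x≥y⇒x⊔ₗy≡x {y = 0²} (<⇒≤ₗ (+<+ (s≤s z≤n)))) (cong (1ℤ ,_) (identity (+ n)))
    where
    identity : ∀ n → 0ℤ + - n + -1ℤ ≡ - (1ℤ + n)
    identity = solve-∀

  ev-¬ε^ : ∀ n → eval (Ł₂ 1 1) (ε ^ₜ ℕ.suc n ⇒ₜ (varₜ ·ₜ varₜ)) γ₁ ≡ (0ℤ , + ℕ.suc n)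
  ev-¬ε^ n rewrite ev-ε^ n =
    trans (x≤y⇒x⊓ₗy≡x {y = 1ℤ , 1ℤ} (<⇒≤ₗ (+<+ (s≤s z≤n)))) (cong (0ℤ ,_) (identity (+ n)))
    where
    identity : ∀ n → 1ℤ + - - n + 0ℤ ≡ 1ℤ + n
    identity = solve-∀

  γ₁-generates : ∀ x → RawHoop.U (Ł₂ 1 1) x → InGenerated (Ł₂ 1 1) γ₁ x
  γ₁-generates x x∈ = generated x (U⇒InΓ x x∈)
    where
    generated : ∀ x → InΓ (1ℤ , 1ℤ) x → InGenerated (Ł₂ 1 1) γ₁ x
    generated (+ 0 , + 0) _ = varₜ ·ₜ varₜ , refl
    generated (+ 0 , + ℕ.suc n) _ = ε ^ₜ ℕ.suc n ⇒ₜ (varₜ ·ₜ varₜ) , sym (ev-¬ε^ n)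
    generated (+ 1 , + 0) _ = ε , refl
    generated (+ 1 , + 1) _ = oneₜ , refl
    generated (+ 1 , ℤ.-[1+ n ]) _ = ε ^ₜ ℕ.suc (ℕ.suc n) , sym (ev-ε^ (ℕ.suc n))
    generated (+ 0 , ℤ.-[1+ n ]) (0≤x , _) with ≤ₗ-cases 0≤x
    ... | inj₁ (+<+ ())
    ... | inj₂ (_ , ())
    generated (+ 1 , + ℕ.suc (ℕ.suc n)) (_ , x≤u) with ≤ₗ-cases x≤u
    ... | inj₁ (+<+ (s≤s ()))
    ... | inj₂ (_ , +≤+ (s≤s ()))
    generated (+ ℕ.suc (ℕ.suc a) , b) (_ , x≤u) with ≤ₗ-cases x≤u
    ... | inj₁ (+<+ (s≤s ()))
    ... | inj₂ (() , _)
    generated (ℤ.-[1+ a ] , b) (0≤x , _) with ≤ₗ-cases 0≤x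
    ... | inj₁ ()
    ... | inj₂ (() , _)

  shear-injective : ∀ q {x y} → shear q 1 x ≡ shear q 1 y → x ≡ y
  shear-injective q {a , b} {c , d} eq with cong proj₁ eq
  ... | refl = cong (a ,_) (begin
    b                        ≡⟨ cancel (q * a) b ⟩
    q * a + + 1 * b - q * a   ≡⟨ cong (_- q * a) (cong proj₂ eq) ⟩
    q * a + + 1 * d - q * a   ≡⟨ sym (cancel (q * a) d) ⟩
    d                        ∎)
    where
    open ≡-Reasoning
    cancel : ∀ x b → b ≡ x + + 1 * b - x
    cancel = solve-∀

module SmallJEmbedding {I J} (P : ReducedPresentation I J) {gsel} (sel : IsGenSelection gsel) (1∈J : 1 ∈ J) where
  open Terms (bound P)
  open Representatives γ₁-generates

  private
    m : ℕ
    m = bound P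
    1<m : 1 ℕ.< m
    1<m = proj₂ (∈↓J⇒<bound P (1 , 1∈J , ∣-refl))

    u : ℤ²
    u = (1ℤ , 0ℤ)
    0≤u : 0² ≤ₗ u
    0≤u = <⇒≤ₗ (+<+ (s≤s z≤n))

  opaque
    F : ℤ² → Term
    F x = representative x [ varₜ ] ∨ₜ indicator varₜ

    F-unfold : ∀ x → F x ≡ representative x [ varₜ ] ∨ₜ indicator varₜ
    F-unfold x = refl

  private
    near : ∀ b → HomomorphicAt (1ℤ , 1ℤ) F (1ℤ , 0ℤ) (0ℤ , + b)
    near b = near⇒homomorphicAt 0≤u v∈ varₜ (indicator varₜ) representative F-unfold represents
               (shear-isΓHom (- + b) b shear-u) (cong (0ℤ ,_) (sym (identity (+ b))))
               (Evaluation.ev-indicator-zero m 0≤u v∈ (+<+ (s≤s z≤n)) (+<+ 1<m) varₜ refl (+≤+ (s≤s z≤n)))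
      where
      v∈ : InΓ u (0ℤ , + b)
      v∈ = ≤⇒≤ₗ (0≤+ b) , <⇒≤ₗ (+<+ (s≤s z≤n))
      identity : ∀ b → - b * 0ℤ + b * 1ℤ ≡ b
      identity = solve-∀
      shear-u : shear (- + b) b (1ℤ , 1ℤ) ≡ u
      shear-u = cong (1ℤ ,_) (cancel (+ b))
        where
        cancel : ∀ b → - b * 1ℤ + b * 1ℤ ≡ 0ℤ
        cancel = solve-∀

    far : ∀ {k h} → 1 ℕ.≤ h → h ℕ.< k → k ℕ.< m → HomomorphicAt (1ℤ , 1ℤ) F (+ k , 0ℤ) (ι (+ h))
    far {k} {h} 1≤h h<k k<m = far⇒homomorphicAt 0≤u′ v∈ varₜ (indicator varₜ) representative F-unfold
      (Evaluation.ev-indicator-pos m 0≤u′ v∈ (+<+ h<k) (+<+ k<m) varₜ (+≤+ 1≤h))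
      where
      0≤u′ : 0² ≤ₗ (+ k , 0ℤ)
      0≤u′ = <⇒≤ₗ (+<+ (ℕP.≤-<-trans z≤n h<k))
      v∈ : InΓ (+ k , 0ℤ) (+ h , 0ℤ)
      v∈ = <⇒≤ₗ (+<+ 1≤h) , <⇒≤ₗ (+<+ h<k)

    at-coatom : ∀ x → eval (Ł₂ 1 0) (F x) (top-minus 1) ≡ u
    at-coatom x = trans (eval-top-minus (F x)) (cong top-minus (trans (cong count (F-unfold x))
      (count-embedding m (representative x) varₜ (indicator varₜ) (count-indicator m varₜ 1<m))))

    0≤γ : 0² ≤ₗ (1ℤ , 1ℤ)
    0≤γ = <⇒≤ₗ (+<+ (s≤s z≤n))

    embedding : ℤ² → RawHoop.Carrier (A-Δ I J)
    embedding = evalΔ I J (gbar gsel) (Ł₂ 1 1) F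

    homomorphicAt-g : ∀ k h → InΔ I J k h f0 → HomomorphicAt (1ℤ , 1ℤ) F (+ k , + h) (gsel k h)
    homomorphicAt-g k h (k∈ , h<k , _) with J↓≡1 P 1∈J k∈ | h<k
    ... | refl | s≤s z≤n = subst (HomomorphicAt (1ℤ , 1ℤ) F u) (sym (proj₂ sel)) (near 1)

    homomorphicAt-¬g : ∀ k h → InΔ I J k h (fs f0) →
                       HomomorphicAt (1ℤ , 1ℤ) F (+ k , + h) (negΓ ℤ×ℤ-OAG (+ k , + h) (gsel k h))
    homomorphicAt-¬g k h (k∈ , h<k , _) with J↓≡1 P 1∈J k∈ | h<k
    ... | refl | s≤s z≤n = subst (λ g → HomomorphicAt (1ℤ , 1ℤ) F u (negΓ ℤ×ℤ-OAG u g)) (sym (proj₂ sel))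
      ((λ _ → u) , const-isΓHom 0≤u , λ x _ → at-coatom x)

    homomorphicAt-h : ∀ k h → InΔ I J k h (fs (fs f0)) → HomomorphicAt (1ℤ , 1ℤ) F (+ k , 0ℤ) (ι (+ h))
    homomorphicAt-h 0 _ (k∈ , _) = ⊥-elim (ℕP.n≮0 (proj₁ (∈↓I⇒<bound P k∈)))
    homomorphicAt-h 1 0 _ = near 0
    homomorphicAt-h 1 (ℕ.suc _) (_ , s≤s () , _)
    homomorphicAt-h (ℕ.suc (ℕ.suc _)) h (k∈ , h<k , cop) =
      far (coprime⇒1≤ (s≤s (s≤s z≤n)) cop) h<k (proj₂ (∈↓I⇒<bound P k∈))

    components : ∀ k h i → InΔ I J k h i → PreservesOps (Ł₂ 1 1) (Aᵢ k h i) (λ x → embedding x k h i)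
    components k h f0 d = homomorphicAt⇒preservesOps {F = F} {v = gbar gsel k h f0} 0≤γ (homomorphicAt-g k h d)
    components k h (fs f0) d =
      homomorphicAt⇒preservesOps {F = F} {v = gbar gsel k h (fs f0)} 0≤γ (homomorphicAt-¬g k h d)
    components k h (fs (fs f0)) d = homomorphicAt-ι⇒preservesOps {F = F} {a = + h} 0≤γ (homomorphicAt-h k h d)

    injective : ∀ x y → RawHoop.U (Ł₂ 1 1) x → RawHoop.U (Ł₂ 1 1) y →
                RawHoop._≈_ (A-Δ I J) (embedding x) (embedding y) → x ≡ y
    injective x y x∈ y∈ eq = shear-injective -1ℤ (trans (sym (at-γ x (U⇒InΓ x x∈)))
                                                (trans (eq 1 0 f0 ((1 , 1∈J , ∣-refl) , s≤s z≤n , cop-1-0))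
                                                       (at-γ y (U⇒InΓ y y∈))))
      where
      cop-1-0 : Coprime 1 0
      cop-1-0 = Cop.1-coprimeTo 0
      at-γ : ∀ x → InΓ (1ℤ , 1ℤ) x → eval (Ł₂ 1 0) (F x) (gsel 1 0) ≡ shear -1ℤ 1 x
      at-γ x x∈ = trans (cong (eval (Ł₂ 1 0) (F x)) (proj₂ sel)) (proj₂ (proj₂ (near 1)) x x∈)

  embeddable : EmbeddableInGenerated (Ł₂ 1 1) (A-Δ I J) (gbar gsel)
  embeddable = componentwise⇒embeddable I J (gbar gsel) (Ł₂ 1 1) F components injective

lemma4p10 : (I J : List ℕ) → ReducedPresentation I J →
    (gsel : ℕ → ℕ → ℤ × ℤ) → IsGenSelection gsel →
    ∀ {j} → j ∈ J → EmbeddableInGenerated (Ł₂ j 1) (A-Δ I J) (gbar gsel)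
lemma4p10 I J P gsel sel {ℕ.zero} 0∈J = ⊥-elim (ℕP.<-irrefl refl (ReducedPresentation.J-pos P 0∈J))
lemma4p10 I J P gsel sel {1} 1∈J = SmallJEmbedding.embeddable P sel 1∈J
lemma4p10 I J P gsel sel {ℕ.suc (ℕ.suc _)} j∈J = LargeJEmbedding.embeddable P sel (s≤s z≤n) j∈J
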